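{- $\mathrm{EquSLP}\le_{\mathrm{P}}\mathrm{3SoSSLP}$ (polynomial-time many-one reducibility).
   Context: A (division-free, constant-free) straight-line program (SLP) representing an integer is a sequence $(b_0,\dots,b_m)$ with $b_0=1$ and $b_i=b_j\circ_i b_k$ for $j,k<i$, $\circ_i\in\{+,-,\times\}$; it represents $N=b_m$. $\mathrm{EquSLP}$: given an SLP representing $N\in\mathbb{Z}$, decide whether $N=0$. $\mathrm{3SoSSLP}$: given an SLP representing $N\in\mathbb{Z}$, decide whether $N$ is a sum of squares of three integers. -}

module Defs where

open import Data.Bool using (Bool; true; false)
open import Data.Nat using (ℕ; zero; suc; _+_; _*_; _^_; _≤_; _<_)
open import Data.Nat.Binary.Base using (ℕᵇ; 2[1+_]; 1+[2_]) renaming (zero to zeroᵇ; fromℕ to toℕᵇ)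
open import Data.Integer using (ℤ) renaming (_+_ to _+ℤ_; _-_ to _-ℤ_; _*_ to _*ℤ_)
import Data.Integer as ℤ
open import Data.List using (List; []; _∷_; _++_; length)
open import Data.Fin using (Fin) renaming (zero to fz; suc to fs)
open import Data.Maybe using (Maybe; just; nothing)
open import Data.Product using (Σ; _×_; _,_)
open import Data.Unit using (⊤)
open import Relation.Binary.PropositionalEquality using (_≡_)

data Op : Set where
  plus minus times : Op

-- An instruction  b_i = b_j ∘ b_k  is stored as (∘ , j , k).
Instr : Set
Instr = Op × ℕ × ℕ

-- An SLP (b_0 , … , b_m) with b_0 = 1 is the list of its m instructions
-- for b_1 , … , b_m (in order).
SLP : Set
SLP = List Instr

ValidFrom : ℕ → SLP → Set
ValidFrom i [] = ⊤
ValidFrom i ((o , j , k) ∷ P) = j < i × k < i × ValidFrom (suc i) P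

Valid : SLP → Set
Valid P = ValidFrom 1 P

-- lookup with a default (only used at valid indices)
at : List ℤ → ℕ → ℤ
at [] _ = ℤ.0ℤ
at (x ∷ xs) zero = x
at (x ∷ xs) (suc n) = at xs n

applyOp : Op → ℤ → ℤ → ℤ
applyOp plus a b = a +ℤ b
applyOp minus a b = a -ℤ b
applyOp times a b = a *ℤ b

evalFrom : List ℤ → ℤ → SLP → ℤ
evalFrom vals lastv [] = lastv
evalFrom vals lastv ((o , j , k) ∷ P) =
  let v = applyOp o (at vals j) (at vals k) in evalFrom (vals ++ (v ∷ [])) v P

value : SLP → ℤ
value P = evalFrom (ℤ.1ℤ ∷ []) ℤ.1ℤ P

-- natural numbers in bijective base 2 (digits 1,2), least significant
-- digit first; each digit is a pair of bits starting with true,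
-- and the number is terminated by  false false.
encℕᵇ : ℕᵇ → List Bool
encℕᵇ zeroᵇ = false ∷ false ∷ []
encℕᵇ 2[1+ x ] = true ∷ false ∷ encℕᵇ x
encℕᵇ 1+[2 x ] = true ∷ true ∷ encℕᵇ x

encℕ : ℕ → List Bool
encℕ n = encℕᵇ (toℕᵇ n)

encOp : Op → List Bool
encOp plus  = false ∷ false ∷ []
encOp minus = false ∷ true ∷ []
encOp times = true ∷ false ∷ []

encSLP : SLP → List Bool
encSLP [] = []
encSLP ((o , j , k) ∷ P) = encOp o ++ encℕ j ++ encℕ k ++ encSLP P

Language : Set₁
Language = List Bool → Set

IsSumOf3Squares : ℤ → Set
IsSumOf3Squares N = Σ ℤ λ a → Σ ℤ λ b → Σ ℤ λ c → N ≡ (a *ℤ a) +ℤ (b *ℤ b) +ℤ (c *ℤ c)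

EquSLP : Language
EquSLP w = Σ SLP λ P → Valid P × encSLP P ≡ w × value P ≡ ℤ.0ℤ

3SoSSLP : Language
3SoSSLP w = Σ SLP λ P → Valid P × encSLP P ≡ w × IsSumOf3Squares (value P)

-- tape alphabet Fin (3 + Γ): 0 = blank, 1 = bit 0, 2 = bit 1, rest extra
data Move : Set where
  left right stay : Move

record TM : Set where
  field
    Q     : ℕ
    Γ     : ℕ
    start : Fin Q
    -- nothing = halt
    δ     : Fin Q → Fin (3 + Γ) → Maybe (Fin Q × Fin (3 + Γ) × Move)

module _ (M : TM) where
  open TM M

  Sym : Set
  Sym = Fin (3 + Γ)

  -- state, cells left of head (nearest first), head cell, cells right of head
  record Config : Set where
    constructor conf
    field
      state : Fin Q
      lefts : List Sym
      head  : Sym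
      rights : List Sym

  blank : Sym
  blank = fz

  bitSym : Bool → Sym
  bitSym false = fs fz
  bitSym true  = fs (fs fz)

  moveHead : Move → List Sym → Sym → List Sym → Config → Config
  moveHead stay ls h rs (conf q _ _ _) = conf q ls h rs
  moveHead left [] h rs (conf q _ _ _) = conf q [] h rs          -- left end: stay
  moveHead left (l ∷ ls) h rs (conf q _ _ _) = conf q ls l (h ∷ rs)
  moveHead right ls h [] (conf q _ _ _) = conf q (h ∷ ls) blank []
  moveHead right ls h (r ∷ rs) (conf q _ _ _) = conf q (h ∷ ls) r rs

  step : Config → Maybe Config
  step (conf q ls h rs) with δ q h
  ... | nothing = nothing
  ... | just (q' , s , m) = just (moveHead m ls s rs (conf q' ls s rs))

  haltsWithin : ℕ → Config → Maybe Config
  haltsWithin zero c with step c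
  ... | nothing = just c
  ... | just _ = nothing
  haltsWithin (suc t) c with step c
  ... | nothing = just c
  ... | just c' = haltsWithin t c'

  initConf : List Bool → Config
  initConf [] = conf start [] blank []
  initConf (b ∷ w) = conf start [] (bitSym b) (Data.List.map bitSym w)

  readBits : List Sym → List Bool
  readBits [] = []
  readBits (fz ∷ _) = []
  readBits (fs fz ∷ xs) = false ∷ readBits xs
  readBits (fs (fs fz) ∷ xs) = true ∷ readBits xs
  readBits (fs (fs (fs _)) ∷ _) = []

  output : Config → List Bool
  output (conf _ _ h rs) = readBits (h ∷ rs)

PolyTimeComputable : (List Bool → List Bool) → Set
PolyTimeComputable f =
  Σ TM λ M → Σ ℕ λ c → Σ ℕ λ k → ∀ w →
    Σ ℕ λ t → t ≤ c * (suc (length w)) ^ k ×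
      Σ (Config M) λ c' → haltsWithin M t (initConf M w) ≡ just c' × output M c' ≡ f w

_≤P_ : Language → Language → Set
A ≤P B = Σ (List Bool → List Bool) λ f → PolyTimeComputable f ×
           (∀ w → (A w → B (f w)) × (B (f w) → A w))

-- The reduction sends the encoding of a nonempty SLP computing N to the encoding of the same SLP
-- extended by three instructions computing (0 - N) · N = -N², and every other word to 11, which
-- encodes no SLP. A sum of three squares is nonnegative, so -N² is one iff N = 0; as the encoding
-- of SLPs is injective, this is a many-one reduction.
--
-- It is computed by a single-tape machine which checks the input against the grammar of encodings
-- while marking the first bit of every instruction, and then makes four passes over the tape. Each
-- pass counts the marks into a counter in bijective base 2 kept at the right end of the tape and
-- finally turns it into the digits of one of the indices m + 1, m, m + 2, m of the new instructions
-- (m the number of instructions). A pass makes one round trip per instruction over a tape of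
-- length O(n), so the machine runs in time O(n²).

module Submission where

open import Defs
open import Data.Bool using (Bool; true; false; not)
open import Data.Fin using (Fin; #_) renaming (zero to fz)
open import Data.Integer using (ℤ; +0; -[1+_]; +[1+_]; ∣_∣; 0ℤ; 1ℤ) renaming (_-_ to _-ℤ_; _*_ to _*ℤ_)
import Data.Integer as ℤ
open import Data.List using (List; []; _∷_; _++_; length; map; _ʳ++_; reverse)
open import Data.List.Properties
  using ( ++-assoc; ++-identityʳ; ++-ʳ++; ʳ++-defn; ∷-injectiveʳ; length-++; length-++-≤ˡ; length-++-≤ʳ; length-map
        ; length-reverse; map-++; map-∘; map-cong; map-id; reverse-map; reverse-involutive; ++-monoid)
open import Data.List.Relation.Unary.All using (All; []; _∷_)
import Data.List.Relation.Unary.All as All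
open import Data.List.Relation.Unary.All.Properties using (++⁺; ++⁻ˡ; ++⁻ʳ; map⁺)
open import Data.Maybe using (Maybe; just; nothing; _>>=_)
import Data.Maybe as Maybe
open import Data.Nat using (ℕ; zero; suc; _+_; _*_; _^_; _≤_; _<_; z≤n; s≤s)
open import Data.Nat.Binary.Base
  using (ℕᵇ; 2[1+_]; 1+[2_]; toℕ; fromℕ') renaming (zero to zeroᵇ; suc to sucᵇ; fromℕ to toℕᵇ)
open import Data.Nat.Binary.Properties using (fromℕ-injective; fromℕ-toℕ; fromℕ≡fromℕ')
open import Data.Nat.Properties
  using ( ≤-refl; ≤-trans; ≤-reflexive; <-≤-trans; n≤1+n; m≤m+n; m≤n+m; +-mono-≤; +-monoˡ-≤; +-monoʳ-≤
        ; *-monoˡ-≤; *-monoʳ-≤; +-suc; +-identityʳ; +-assoc; +-comm; module ≤-Reasoning)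
open import Data.Nat.Solver using (module +-*-Solver)
open +-*-Solver using (_:+_; _:*_; con; _:=_) renaming (solve to solve-ℕ)
open import Algebra.Solver.Monoid (++-monoid Bool) using (_⊜_; _⊕_) renaming (solve to solve-++)
open import Data.Product using (Σ-syntax; _×_; _,_)
open import Data.Unit using (tt)
open import Data.Vec using (Vec; []; _∷_; lookup)
open import Function using (id; _∘_)
open import Relation.Nullary using (¬_)
open import Relation.Binary.PropositionalEquality
  using (_≡_; _≢_; refl; sym; trans; cong; cong₂; subst; module ≡-Reasoning)

-- Straight-line programs

-- Appended to an SLP with m instructions: b_{m+1} = 1 - 1, b_{m+2} = b_{m+1} - b_m, b_{m+3} = b_{m+2} · b_m = - b_m².
negSquareSuffix : ℕ → SLP
negSquareSuffix m = (minus , 0 , 0) ∷ (minus , suc m , m) ∷ (times , suc (suc m) , m) ∷ []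

encSLP-++ : ∀ P Q → encSLP (P ++ Q) ≡ encSLP P ++ encSLP Q
encSLP-++ [] Q = refl
encSLP-++ ((o , j , k) ∷ P) Q = begin
  encOp o ++ encℕ j ++ encℕ k ++ encSLP (P ++ Q)
    ≡⟨ cong (λ z → encOp o ++ encℕ j ++ encℕ k ++ z) (encSLP-++ P Q) ⟩
  encOp o ++ encℕ j ++ encℕ k ++ encSLP P ++ encSLP Q
    ≡⟨ cong (λ z → encOp o ++ encℕ j ++ z) (++-assoc (encℕ k) (encSLP P) (encSLP Q)) ⟨
  encOp o ++ encℕ j ++ (encℕ k ++ encSLP P) ++ encSLP Q
    ≡⟨ cong (encOp o ++_) (++-assoc (encℕ j) _ (encSLP Q)) ⟨
  encOp o ++ (encℕ j ++ encℕ k ++ encSLP P) ++ encSLP Q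
    ≡⟨ ++-assoc (encOp o) _ (encSLP Q) ⟨
  (encOp o ++ encℕ j ++ encℕ k ++ encSLP P) ++ encSLP Q ∎
  where open ≡-Reasoning

encℕᵇ-++-injective : ∀ x y {r r′} → encℕᵇ x ++ r ≡ encℕᵇ y ++ r′ → x ≡ y × r ≡ r′
encℕᵇ-++-injective zeroᵇ    zeroᵇ    eq = refl , ∷-injectiveʳ (∷-injectiveʳ eq)
encℕᵇ-++-injective 2[1+ x ] 2[1+ y ] eq with encℕᵇ-++-injective x y (∷-injectiveʳ (∷-injectiveʳ eq))
... | refl , r≡r′ = refl , r≡r′
encℕᵇ-++-injective 1+[2 x ] 1+[2 y ] eq with encℕᵇ-++-injective x y (∷-injectiveʳ (∷-injectiveʳ eq))
... | refl , r≡r′ = refl , r≡r′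
encℕᵇ-++-injective zeroᵇ    2[1+ _ ] ()
encℕᵇ-++-injective zeroᵇ    1+[2 _ ] ()
encℕᵇ-++-injective 2[1+ _ ] zeroᵇ    ()
encℕᵇ-++-injective 2[1+ _ ] 1+[2 _ ] ()
encℕᵇ-++-injective 1+[2 _ ] zeroᵇ    ()
encℕᵇ-++-injective 1+[2 _ ] 2[1+ _ ] ()

encℕ-++-injective : ∀ x y {r r′} → encℕ x ++ r ≡ encℕ y ++ r′ → x ≡ y × r ≡ r′
encℕ-++-injective x y eq with encℕᵇ-++-injective (toℕᵇ x) (toℕᵇ y) eq
... | x≡y , r≡r′ = fromℕ-injective x≡y , r≡r′

encOp-++-injective : ∀ o o′ {r r′} → encOp o ++ r ≡ encOp o′ ++ r′ → o ≡ o′ × r ≡ r′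
encOp-++-injective plus  plus  refl = refl , refl
encOp-++-injective minus minus refl = refl , refl
encOp-++-injective times times refl = refl , refl
encOp-++-injective plus  minus ()
encOp-++-injective plus  times ()
encOp-++-injective minus plus  ()
encOp-++-injective minus times ()
encOp-++-injective times plus  ()
encOp-++-injective times minus ()

encSLP-∷≢[] : ∀ i P → ¬ encSLP (i ∷ P) ≡ []
encSLP-∷≢[] (plus  , _) P ()
encSLP-∷≢[] (minus , _) P ()
encSLP-∷≢[] (times , _) P ()

encSLP-injective : ∀ P Q → encSLP P ≡ encSLP Q → P ≡ Q
encSLP-injective [] [] eq = refl
encSLP-injective [] (i ∷ Q) eq with () ← encSLP-∷≢[] i Q (sym eq)
encSLP-injective (i ∷ P) [] eq with () ← encSLP-∷≢[] i P eq
encSLP-injective ((o , j , k) ∷ P) ((o′ , j′ , k′) ∷ Q) eq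
  with refl , eq₁ ← encOp-++-injective o o′ eq
  with refl , eq₂ ← encℕ-++-injective j j′ eq₁
  with refl , eq₃ ← encℕ-++-injective k k′ eq₂
  = cong ((o , j , k) ∷_) (encSLP-injective P Q eq₃)

encSLP≢11 : ∀ P → ¬ encSLP P ≡ true ∷ true ∷ []
encSLP≢11 [] ()
encSLP≢11 ((plus  , _) ∷ P) ()
encSLP≢11 ((minus , _) ∷ P) ()
encSLP≢11 ((times , _) ∷ P) ()

ValidFrom-++ : ∀ i P Q → ValidFrom i P → ValidFrom (i + length P) Q → ValidFrom i (P ++ Q)
ValidFrom-++ i [] Q _ vQ = subst (λ n → ValidFrom n Q) (+-identityʳ i) vQ
ValidFrom-++ i (_ ∷ P) Q (j< , k< , vP) vQ =
  j< , k< , ValidFrom-++ (suc i) P Q vP (subst (λ n → ValidFrom n Q) (+-suc i (length P)) vQ)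

ValidFrom-++⁻ˡ : ∀ i P Q → ValidFrom i (P ++ Q) → ValidFrom i P
ValidFrom-++⁻ˡ i [] Q _ = tt
ValidFrom-++⁻ˡ i (_ ∷ P) Q (j< , k< , v) = j< , k< , ValidFrom-++⁻ˡ (suc i) P Q v

negSquareSuffix-valid : ∀ m → ValidFrom (suc m) (negSquareSuffix m)
negSquareSuffix-valid m =
  s≤s z≤n , s≤s z≤n , ≤-refl , n≤1+n _ , ≤-refl , ≤-trans (n≤1+n _) (n≤1+n _) , tt

at-++ˡ : ∀ xs ys {i} → i < length xs → at (xs ++ ys) i ≡ at xs i
at-++ˡ (x ∷ xs) ys {zero}  _         = refl
at-++ˡ (x ∷ xs) ys {suc i} (s≤s i<) = at-++ˡ xs ys i<

at-++-length : ∀ xs y ys → at (xs ++ y ∷ ys) (length xs) ≡ y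
at-++-length []       y ys = refl
at-++-length (x ∷ xs) y ys = at-++-length xs y ys

valuesFrom : List ℤ → SLP → List ℤ
valuesFrom vals [] = vals
valuesFrom vals ((o , j , k) ∷ P) = valuesFrom (vals ++ applyOp o (at vals j) (at vals k) ∷ []) P

evalFrom-++ : ∀ vals l P Q → evalFrom vals l (P ++ Q) ≡ evalFrom (valuesFrom vals P) (evalFrom vals l P) Q
evalFrom-++ vals l [] Q = refl
evalFrom-++ vals l (_ ∷ P) Q = evalFrom-++ _ _ P Q

length-valuesFrom : ∀ vals P → length (valuesFrom vals P) ≡ length vals + length P
length-valuesFrom vals [] = sym (+-identityʳ _)
length-valuesFrom vals (_ ∷ P) =
  trans (length-valuesFrom (vals ++ _ ∷ []) P)
        (trans (cong (_+ length P) (length-++ vals)) (+-assoc (length vals) 1 (length P)))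

at-valuesFrom : ∀ vals P {i} → i < length vals → at (valuesFrom vals P) i ≡ at vals i
at-valuesFrom vals [] i< = refl
at-valuesFrom vals (_ ∷ P) {i} i< = trans
  (at-valuesFrom (vals ++ _ ∷ []) P (<-≤-trans i< (subst (length vals ≤_) (sym (length-++ vals)) (m≤m+n _ 1))))
  (at-++ˡ vals _ i<)

at-valuesFrom-last : ∀ vs l P → at (valuesFrom (vs ++ l ∷ []) P) (length vs + length P) ≡ evalFrom (vs ++ l ∷ []) l P
at-valuesFrom-last vs l [] = trans (cong (at (vs ++ l ∷ [])) (+-identityʳ (length vs))) (at-++-length vs l [])
at-valuesFrom-last vs l ((o , j , k) ∷ P) = begin
  at (valuesFrom ((vs ++ l ∷ []) ++ v ∷ []) P) (length vs + suc (length P))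
    ≡⟨ cong (at (valuesFrom ((vs ++ l ∷ []) ++ v ∷ []) P)) index≡ ⟩
  at (valuesFrom ((vs ++ l ∷ []) ++ v ∷ []) P) (length (vs ++ l ∷ []) + length P)
    ≡⟨ at-valuesFrom-last (vs ++ l ∷ []) v P ⟩
  evalFrom ((vs ++ l ∷ []) ++ v ∷ []) v P ∎
  where
  open ≡-Reasoning
  v = applyOp o (at (vs ++ l ∷ []) j) (at (vs ++ l ∷ []) k)
  index≡ : length vs + suc (length P) ≡ length (vs ++ l ∷ []) + length P
  index≡ = trans (sym (+-assoc (length vs) 1 (length P))) (cong (_+ length P) (sym (length-++ vs)))

evalFrom-negSquareSuffix : ∀ vals l m → length vals ≡ suc m → at vals 0 ≡ 1ℤ →
  evalFrom vals l (negSquareSuffix m) ≡ (0ℤ -ℤ at vals m) *ℤ at vals m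
evalFrom-negSquareSuffix vals l m len at0 = cong₂ _*ℤ_ b₂≡ b₀≡
  where
  N = at vals m
  b₁ = at vals 0 -ℤ at vals 0
  vals₁ = vals ++ b₁ ∷ []
  b₂ = at vals₁ (suc m) -ℤ at vals₁ m
  vals₂ = vals₁ ++ b₂ ∷ []
  m<len : m < length vals
  m<len = subst (m <_) (sym len) ≤-refl
  len₁ : length vals₁ ≡ suc (suc m)
  len₁ = trans (length-++ vals) (trans (+-comm (length vals) 1) (cong suc len))
  b₁≡0 : b₁ ≡ 0ℤ
  b₁≡0 = cong (λ b → b -ℤ b) at0
  atN : at vals₁ m ≡ N
  atN = at-++ˡ vals _ m<len
  b₂≡ : at vals₂ (suc (suc m)) ≡ 0ℤ -ℤ N
  b₂≡ = begin
    at vals₂ (suc (suc m))  ≡⟨ cong (at vals₂) len₁ ⟨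
    at vals₂ (length vals₁) ≡⟨ at-++-length vals₁ b₂ [] ⟩
    b₂                      ≡⟨ cong₂ _-ℤ_ (trans (cong (at vals₁) (sym len)) (at-++-length vals b₁ [])) atN ⟩
    b₁ -ℤ N                 ≡⟨ cong (_-ℤ N) b₁≡0 ⟩
    0ℤ -ℤ N                 ∎
    where open ≡-Reasoning
  b₀≡ : at vals₂ m ≡ N
  b₀≡ = trans (at-++ˡ vals₁ _ (<-≤-trans m<len (subst (length vals ≤_) (sym (length-++ vals)) (m≤m+n _ 1)))) atN

value-++-negSquareSuffix : ∀ P → value (P ++ negSquareSuffix (length P)) ≡ (0ℤ -ℤ value P) *ℤ value P
value-++-negSquareSuffix P = begin
  value (P ++ negSquareSuffix (length P))
    ≡⟨ evalFrom-++ (1ℤ ∷ []) 1ℤ P _ ⟩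
  evalFrom vals (value P) (negSquareSuffix (length P))
    ≡⟨ evalFrom-negSquareSuffix vals (value P) (length P)
         (length-valuesFrom (1ℤ ∷ []) P) (at-valuesFrom (1ℤ ∷ []) P (s≤s z≤n)) ⟩
  (0ℤ -ℤ at vals (length P)) *ℤ at vals (length P)
    ≡⟨ cong (λ N → (0ℤ -ℤ N) *ℤ N) (at-valuesFrom-last [] 1ℤ P) ⟩
  (0ℤ -ℤ value P) *ℤ value P ∎
  where
  open ≡-Reasoning
  vals = valuesFrom (1ℤ ∷ []) P

square≡+∣∣² : ∀ a → a *ℤ a ≡ ℤ.+ (∣ a ∣ * ∣ a ∣)
square≡+∣∣² +0       = refl
square≡+∣∣² +[1+ _ ] = refl
square≡+∣∣² -[1+ _ ] = refl

-- For N ≠ 0 the left side is a negative constructor while a sum of squares of naturals is a + _ .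
negSquare-sumOf3Squares⇒≡0 : ∀ N → IsSumOf3Squares ((0ℤ -ℤ N) *ℤ N) → N ≡ 0ℤ
negSquare-sumOf3Squares⇒≡0 +0       _ = refl
negSquare-sumOf3Squares⇒≡0 +[1+ _ ] (a , b , c , eq)
  rewrite square≡+∣∣² a | square≡+∣∣² b | square≡+∣∣² c with () ← eq
negSquare-sumOf3Squares⇒≡0 -[1+ _ ] (a , b , c , eq)
  rewrite square≡+∣∣² a | square≡+∣∣² b | square≡+∣∣² c with () ← eq

0-sumOf3Squares : IsSumOf3Squares 0ℤ
0-sumOf3Squares = 0ℤ , 0ℤ , 0ℤ , refl

-- Turing machines over finite types of states and cells

module Runs (M : TM) where

  steps : ℕ → Config M → Maybe (Config M)
  steps zero    c = just c
  steps (suc n) c with step M c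
  ... | nothing = nothing
  ... | just c′ = steps n c′

  steps-+ : ∀ a b {c d e} → steps a c ≡ just d → steps b d ≡ just e → steps (a + b) c ≡ just e
  steps-+ zero    b refl q = q
  steps-+ (suc a) b {c} p q with step M c
  ... | just c′ = steps-+ a b p q

  _↝[_]_ : Config M → ℕ → Config M → Set
  c ↝[ B ] d = Σ[ a ∈ ℕ ] a ≤ B × steps a c ≡ just d

  infix 4 _↝[_]_

  ↝-refl : ∀ {c} → c ↝[ 0 ] c
  ↝-refl = 0 , z≤n , refl

  ↝-step : ∀ {c d} → step M c ≡ just d → c ↝[ 1 ] d
  ↝-step {c} eq = 1 , ≤-refl , steps-1 eq
    where
    steps-1 : ∀ {d} → step M c ≡ just d → steps 1 c ≡ just d
    steps-1 eq rewrite eq = refl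

  ↝-trans : ∀ {c d e A B} → c ↝[ A ] d → d ↝[ B ] e → c ↝[ A + B ] e
  ↝-trans (a , a≤ , p) (b , b≤ , q) = a + b , +-mono-≤ a≤ b≤ , steps-+ a b p q

  ↝-weaken : ∀ {c d A B} → A ≤ B → c ↝[ A ] d → c ↝[ B ] d
  ↝-weaken A≤B (a , a≤ , p) = a , ≤-trans a≤ A≤B , p

  ↝-cast : ∀ {c c′ d d′ B} → c ≡ c′ → d ≡ d′ → c ↝[ B ] d → c′ ↝[ B ] d′
  ↝-cast refl refl r = r

  Halts : Config M → ℕ → List Bool → Set
  Halts c B out = Σ[ d ∈ Config M ] c ↝[ B ] d × step M d ≡ nothing × output M d ≡ out

  ↝-Halts : ∀ {c d A B out} → c ↝[ A ] d → Halts d B out → Halts c (A + B) out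
  ↝-Halts r (e , r′ , h , o) = e , ↝-trans r r′ , h , o

  Halts-weaken : ∀ {c A B out} → A ≤ B → Halts c A out → Halts c B out
  Halts-weaken A≤B (d , r , h , o) = d , ↝-weaken A≤B r , h , o

  Halts-cast : ∀ {c c′ A B out out′} → c ≡ c′ → A ≡ B → out ≡ out′ → Halts c A out → Halts c′ B out′
  Halts-cast refl refl refl h = h

  haltsWithin-steps : ∀ a {c d} → steps a c ≡ just d → step M d ≡ nothing → haltsWithin M a c ≡ just d
  haltsWithin-steps zero {c} refl h with step M c
  ... | nothing = refl
  haltsWithin-steps zero {c} refl () | just _
  haltsWithin-steps (suc a) {c} s h with step M c
  ... | just c′ = haltsWithin-steps a s h

  haltsWithin-Halts : ∀ {c B out} → Halts c B out →
    Σ[ t ∈ ℕ ] t ≤ B × Σ[ d ∈ Config M ] haltsWithin M t c ≡ just d × output M d ≡ out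
  haltsWithin-Halts (d , (t , t≤ , run) , halted , out) = t , t≤ , d , haltsWithin-steps t run halted , out

record Coding (A : Set) (n : ℕ) : Set where
  field
    encode        : A → Fin n
    decode        : Fin n → A
    decode-encode : ∀ a → decode (encode a) ≡ a

open Coding

module FiniteMachine
  {State Cell : Set} {nQ nΓ : ℕ}
  (stateCoding : Coding State nQ) (cellCoding : Coding Cell (3 + nΓ))
  (␣ : Cell) (encode-␣ : encode cellCoding ␣ ≡ fz)
  (q₀ : State) (δ : State → Cell → Maybe (State × Cell × Move))
  where

  encodeAction : Maybe (State × Cell × Move) → Maybe (Fin nQ × Fin (3 + nΓ) × Move)
  encodeAction nothing = nothing
  encodeAction (just (q , c , m)) = just (encode stateCoding q , encode cellCoding c , m)

  machine : TM
  machine = record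
    { Q = nQ ; Γ = nΓ ; start = encode stateCoding q₀
    ; δ = λ q s → encodeAction (δ (decode stateCoding q) (decode cellCoding s)) }

  open Runs machine public

  head : List Cell → Cell
  head []      = ␣
  head (c ∷ _) = c

  tail : List Cell → List Cell
  tail []       = []
  tail (_ ∷ cs) = cs

  -- The tape left of the head is listed nearest cell first; the head reads the first cell of R,
  -- and an exhausted R stands for blank cells.
  ⟪_∣_∣_⟫ : State → List Cell → List Cell → Config machine
  ⟪ q ∣ L ∣ R ⟫ = conf (encode stateCoding q) (map (encode cellCoding) L)
                       (encode cellCoding (head R)) (map (encode cellCoding) (tail R))

  δ-encode : ∀ q c → TM.δ machine (encode stateCoding q) (encode cellCoding c) ≡ encodeAction (δ q c)
  δ-encode q c rewrite decode-encode stateCoding q | decode-encode cellCoding c = refl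

  private
    step-δ : ∀ {q l h r} a → TM.δ machine q h ≡ encodeAction a →
      step machine (conf q l h r) ≡ Maybe.map (λ (q′ , c , m) →
        moveHead machine m l (encode cellCoding c) r (conf (encode stateCoding q′) l (encode cellCoding c) r)) a
    step-δ nothing eq rewrite eq = refl
    step-δ (just _) eq rewrite eq = refl

  stepR : ∀ {q L R q′ c′} → δ q (head R) ≡ just (q′ , c′ , right) →
    ⟪ q ∣ L ∣ R ⟫ ↝[ 1 ] ⟪ q′ ∣ c′ ∷ L ∣ tail R ⟫
  stepR {q} {L} {R} {q′} {c′} eq =
    ↝-step (trans (step-δ _ (trans (δ-encode q (head R)) (cong encodeAction eq))) (cong just (moveRight R)))
    where
    L′ = map (encode cellCoding) L
    c″ = encode cellCoding c′
    moveRight : ∀ R → let R′ = map (encode cellCoding) (tail R) in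
      moveHead machine right L′ c″ R′ (conf (encode stateCoding q′) L′ c″ R′)
        ≡ ⟪ q′ ∣ c′ ∷ L ∣ tail R ⟫
    moveRight [] = cong (λ b → conf (encode stateCoding q′) (c″ ∷ L′) b []) (sym encode-␣)
    moveRight (_ ∷ []) = cong (λ b → conf (encode stateCoding q′) (c″ ∷ L′) b []) (sym encode-␣)
    moveRight (_ ∷ _ ∷ _) = refl

  stepL : ∀ {q l L R q′ c′} → δ q (head R) ≡ just (q′ , c′ , left) →
    ⟪ q ∣ l ∷ L ∣ R ⟫ ↝[ 1 ] ⟪ q′ ∣ L ∣ l ∷ c′ ∷ tail R ⟫
  stepL {q} {R = R} eq = ↝-step (step-δ _ (trans (δ-encode q (head R)) (cong encodeAction eq)))

  stepS : ∀ {q L R q′ c′} → δ q (head R) ≡ just (q′ , c′ , stay) →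
    ⟪ q ∣ L ∣ R ⟫ ↝[ 1 ] ⟪ q′ ∣ L ∣ c′ ∷ tail R ⟫
  stepS {q} {R = R} eq = ↝-step (step-δ _ (trans (δ-encode q (head R)) (cong encodeAction eq)))

  stepHalt : ∀ {q L R} → δ q (head R) ≡ nothing → step machine ⟪ q ∣ L ∣ R ⟫ ≡ nothing
  stepHalt {q} {R = R} eq = step-δ _ (trans (δ-encode q (head R)) (cong encodeAction eq))

  SweepsRight SweepsLeft : State → (Cell → Cell) → Cell → Set
  SweepsRight q g c = δ q c ≡ just (q , g c , right)
  SweepsLeft  q g c = δ q c ≡ just (q , g c , left)

  sweepRight : ∀ {q g} X {L R} → All (SweepsRight q g) X →
    ⟪ q ∣ L ∣ X ++ R ⟫ ↝[ length X ] ⟪ q ∣ map g X ʳ++ L ∣ R ⟫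
  sweepRight [] [] = ↝-refl
  sweepRight {q} {g} (x ∷ X) {L} {R} (p ∷ ps) = ↝-trans (stepR {q} {L} {x ∷ X ++ R} p) (sweepRight X ps)

  sweepLeft : ∀ {q g} X {l L r R} → All (SweepsLeft q g) X → SweepsLeft q g r →
    ⟪ q ∣ X ʳ++ (l ∷ L) ∣ r ∷ R ⟫ ↝[ suc (length X) ] ⟪ q ∣ L ∣ l ∷ map g X ++ g r ∷ R ⟫
  sweepLeft {q} [] {l} {L} {r} {R} [] pr = stepL {q} {l} {L} {r ∷ R} pr
  sweepLeft {q} {g} (x ∷ X) {l} {L} {r} {R} (p ∷ ps) pr =
    ↝-weaken (≤-reflexive (+-comm (suc (length X)) 1))
      (↝-trans (sweepLeft X {x} {l ∷ L} ps pr) (stepL {q} {l} {L} {x ∷ map g X ++ g r ∷ R} p))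

  skipRight : ∀ {q} X {L R} → All (SweepsRight q id) X →
    ⟪ q ∣ L ∣ X ++ R ⟫ ↝[ length X ] ⟪ q ∣ X ʳ++ L ∣ R ⟫
  skipRight {q} X {L} {R} ps = ↝-cast refl (cong (λ Y → ⟪ q ∣ Y ʳ++ L ∣ R ⟫) (map-id X)) (sweepRight X ps)

  skipLeft : ∀ {q} X {l L r R} → All (SweepsLeft q id) X → SweepsLeft q id r →
    ⟪ q ∣ X ʳ++ (l ∷ L) ∣ r ∷ R ⟫ ↝[ suc (length X) ] ⟪ q ∣ L ∣ l ∷ X ++ r ∷ R ⟫
  skipLeft {q} X {l} {L} {r} {R} ps pr =
    ↝-cast refl (cong (λ Y → ⟪ q ∣ L ∣ l ∷ Y ++ r ∷ R ⟫) (map-id X)) (sweepLeft X ps pr)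

-- The reduction machine

data Cell : Set where
  ␣     : Cell
  bit   : Bool → Cell
  mark  : (parity first b : Bool) → Cell
  digit : Bool → Cell

data Operand : Set where
  opd₁ opd₂ : Operand

data Scan : Set where
  instr op-0 op-1 : Scan
  num num-digit num-end : Operand → Scan

data Pass : Set where
  pass₀ pass₁ pass₂ pass₃ : Pass

data Emit : Set where
  e01 e02 e03 e04 e05 e06 e07 e08 e09 e11 e21 e22 e23 e24 e25 e31 e41 : Emit

data State : Set where
  start reject₁ reject₂ reject₃ halt cleanup : State
  scanning  : Scan → State
  emit      : Emit → State
  seek rewind flush : Pass → State
  toCounter carry grow : Pass → Bool → State

stateTable : Vec State 68
stateTable =
  start ∷ reject₁ ∷ reject₂ ∷ reject₃ ∷ halt ∷ cleanup ∷
  scanning instr ∷ scanning op-0 ∷ scanning op-1 ∷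
  scanning (num opd₁) ∷ scanning (num-digit opd₁) ∷ scanning (num-end opd₁) ∷
  scanning (num opd₂) ∷ scanning (num-digit opd₂) ∷ scanning (num-end opd₂) ∷
  emit e01 ∷ emit e02 ∷ emit e03 ∷ emit e04 ∷ emit e05 ∷ emit e06 ∷ emit e07 ∷ emit e08 ∷ emit e09 ∷
  emit e11 ∷ emit e21 ∷ emit e22 ∷ emit e23 ∷ emit e24 ∷ emit e25 ∷ emit e31 ∷ emit e41 ∷
  seek pass₀ ∷ seek pass₁ ∷ seek pass₂ ∷ seek pass₃ ∷
  rewind pass₀ ∷ rewind pass₁ ∷ rewind pass₂ ∷ rewind pass₃ ∷
  flush pass₀ ∷ flush pass₁ ∷ flush pass₂ ∷ flush pass₃ ∷
  toCounter pass₀ false ∷ toCounter pass₀ true ∷ toCounter pass₁ false ∷ toCounter pass₁ true ∷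
  toCounter pass₂ false ∷ toCounter pass₂ true ∷ toCounter pass₃ false ∷ toCounter pass₃ true ∷
  carry pass₀ false ∷ carry pass₀ true ∷ carry pass₁ false ∷ carry pass₁ true ∷
  carry pass₂ false ∷ carry pass₂ true ∷ carry pass₃ false ∷ carry pass₃ true ∷
  grow pass₀ false ∷ grow pass₀ true ∷ grow pass₁ false ∷ grow pass₁ true ∷
  grow pass₂ false ∷ grow pass₂ true ∷ grow pass₃ false ∷ grow pass₃ true ∷
  []

encodeState : State → Fin 68
encodeState start                       = # 0
encodeState reject₁                     = # 1
encodeState reject₂                     = # 2
encodeState reject₃                     = # 3
encodeState halt                        = # 4
encodeState cleanup                     = # 5
encodeState (scanning instr)            = # 6
encodeState (scanning op-0)             = # 7
encodeState (scanning op-1)             = # 8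
encodeState (scanning (num opd₁))       = # 9
encodeState (scanning (num-digit opd₁)) = # 10
encodeState (scanning (num-end opd₁))   = # 11
encodeState (scanning (num opd₂))       = # 12
encodeState (scanning (num-digit opd₂)) = # 13
encodeState (scanning (num-end opd₂))   = # 14
encodeState (emit e01)                  = # 15
encodeState (emit e02)                  = # 16
encodeState (emit e03)                  = # 17
encodeState (emit e04)                  = # 18
encodeState (emit e05)                  = # 19
encodeState (emit e06)                  = # 20
encodeState (emit e07)                  = # 21
encodeState (emit e08)                  = # 22
encodeState (emit e09)                  = # 23
encodeState (emit e11)                  = # 24
encodeState (emit e21)                  = # 25
encodeState (emit e22)                  = # 26
encodeState (emit e23)                  = # 27
encodeState (emit e24)                  = # 28
encodeState (emit e25)                  = # 29
encodeState (emit e31)                  = # 30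
encodeState (emit e41)                  = # 31
encodeState (seek pass₀)                = # 32
encodeState (seek pass₁)                = # 33
encodeState (seek pass₂)                = # 34
encodeState (seek pass₃)                = # 35
encodeState (rewind pass₀)              = # 36
encodeState (rewind pass₁)              = # 37
encodeState (rewind pass₂)              = # 38
encodeState (rewind pass₃)              = # 39
encodeState (flush pass₀)               = # 40
encodeState (flush pass₁)               = # 41
encodeState (flush pass₂)               = # 42
encodeState (flush pass₃)               = # 43
encodeState (toCounter pass₀ false)     = # 44
encodeState (toCounter pass₀ true)      = # 45
encodeState (toCounter pass₁ false)     = # 46
encodeState (toCounter pass₁ true)      = # 47
encodeState (toCounter pass₂ false)     = # 48
encodeState (toCounter pass₂ true)      = # 49
encodeState (toCounter pass₃ false)     = # 50
encodeState (toCounter pass₃ true)      = # 51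
encodeState (carry pass₀ false)         = # 52
encodeState (carry pass₀ true)          = # 53
encodeState (carry pass₁ false)         = # 54
encodeState (carry pass₁ true)          = # 55
encodeState (carry pass₂ false)         = # 56
encodeState (carry pass₂ true)          = # 57
encodeState (carry pass₃ false)         = # 58
encodeState (carry pass₃ true)          = # 59
encodeState (grow pass₀ false)          = # 60
encodeState (grow pass₀ true)           = # 61
encodeState (grow pass₁ false)          = # 62
encodeState (grow pass₁ true)           = # 63
encodeState (grow pass₂ false)          = # 64
encodeState (grow pass₂ true)           = # 65
encodeState (grow pass₃ false)          = # 66
encodeState (grow pass₃ true)           = # 67

lookup-encodeState : ∀ q → lookup stateTable (encodeState q) ≡ q
lookup-encodeState start                       = refl
lookup-encodeState reject₁                     = refl
lookup-encodeState reject₂                     = refl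
lookup-encodeState reject₃                     = refl
lookup-encodeState halt                        = refl
lookup-encodeState cleanup                     = refl
lookup-encodeState (scanning instr)            = refl
lookup-encodeState (scanning op-0)             = refl
lookup-encodeState (scanning op-1)             = refl
lookup-encodeState (scanning (num opd₁))       = refl
lookup-encodeState (scanning (num-digit opd₁)) = refl
lookup-encodeState (scanning (num-end opd₁))   = refl
lookup-encodeState (scanning (num opd₂))       = refl
lookup-encodeState (scanning (num-digit opd₂)) = refl
lookup-encodeState (scanning (num-end opd₂))   = refl
lookup-encodeState (emit e01)                  = refl
lookup-encodeState (emit e02)                  = refl
lookup-encodeState (emit e03)                  = refl
lookup-encodeState (emit e04)                  = refl
lookup-encodeState (emit e05)                  = refl
lookup-encodeState (emit e06)                  = refl
lookup-encodeState (emit e07)                  = refl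
lookup-encodeState (emit e08)                  = refl
lookup-encodeState (emit e09)                  = refl
lookup-encodeState (emit e11)                  = refl
lookup-encodeState (emit e21)                  = refl
lookup-encodeState (emit e22)                  = refl
lookup-encodeState (emit e23)                  = refl
lookup-encodeState (emit e24)                  = refl
lookup-encodeState (emit e25)                  = refl
lookup-encodeState (emit e31)                  = refl
lookup-encodeState (emit e41)                  = refl
lookup-encodeState (seek pass₀)                = refl
lookup-encodeState (seek pass₁)                = refl
lookup-encodeState (seek pass₂)                = refl
lookup-encodeState (seek pass₃)                = refl
lookup-encodeState (rewind pass₀)              = refl
lookup-encodeState (rewind pass₁)              = refl
lookup-encodeState (rewind pass₂)              = refl
lookup-encodeState (rewind pass₃)              = refl
lookup-encodeState (flush pass₀)               = refl
lookup-encodeState (flush pass₁)               = refl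
lookup-encodeState (flush pass₂)               = refl
lookup-encodeState (flush pass₃)               = refl
lookup-encodeState (toCounter pass₀ false)     = refl
lookup-encodeState (toCounter pass₀ true)      = refl
lookup-encodeState (toCounter pass₁ false)     = refl
lookup-encodeState (toCounter pass₁ true)      = refl
lookup-encodeState (toCounter pass₂ false)     = refl
lookup-encodeState (toCounter pass₂ true)      = refl
lookup-encodeState (toCounter pass₃ false)     = refl
lookup-encodeState (toCounter pass₃ true)      = refl
lookup-encodeState (carry pass₀ false)         = refl
lookup-encodeState (carry pass₀ true)          = refl
lookup-encodeState (carry pass₁ false)         = refl
lookup-encodeState (carry pass₁ true)          = refl
lookup-encodeState (carry pass₂ false)         = refl
lookup-encodeState (carry pass₂ true)          = refl
lookup-encodeState (carry pass₃ false)         = refl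
lookup-encodeState (carry pass₃ true)          = refl
lookup-encodeState (grow pass₀ false)          = refl
lookup-encodeState (grow pass₀ true)           = refl
lookup-encodeState (grow pass₁ false)          = refl
lookup-encodeState (grow pass₁ true)           = refl
lookup-encodeState (grow pass₂ false)          = refl
lookup-encodeState (grow pass₂ true)           = refl
lookup-encodeState (grow pass₃ false)          = refl
lookup-encodeState (grow pass₃ true)           = refl

cellTable : Vec Cell 13
cellTable =
  ␣ ∷ bit false ∷ bit true ∷
  mark false false false ∷ mark false false true ∷ mark false true false ∷ mark false true true ∷
  mark true false false ∷ mark true false true ∷ mark true true false ∷ mark true true true ∷
  digit false ∷ digit true ∷
  []

encodeCell : Cell → Fin 13
encodeCell ␣                        = # 0
encodeCell (bit false)              = # 1
encodeCell (bit true)               = # 2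
encodeCell (mark false false false) = # 3
encodeCell (mark false false true)  = # 4
encodeCell (mark false true false)  = # 5
encodeCell (mark false true true)   = # 6
encodeCell (mark true false false)  = # 7
encodeCell (mark true false true)   = # 8
encodeCell (mark true true false)   = # 9
encodeCell (mark true true true)    = # 10
encodeCell (digit false)            = # 11
encodeCell (digit true)             = # 12

lookup-encodeCell : ∀ c → lookup cellTable (encodeCell c) ≡ c
lookup-encodeCell ␣                        = refl
lookup-encodeCell (bit false)              = refl
lookup-encodeCell (bit true)               = refl
lookup-encodeCell (mark false false false) = refl
lookup-encodeCell (mark false false true)  = refl
lookup-encodeCell (mark false true false)  = refl
lookup-encodeCell (mark false true true)   = refl
lookup-encodeCell (mark true false false)  = refl
lookup-encodeCell (mark true false true)   = refl
lookup-encodeCell (mark true true false)   = refl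
lookup-encodeCell (mark true true true)    = refl
lookup-encodeCell (digit false)            = refl
lookup-encodeCell (digit true)             = refl

stateCoding : Coding State 68
stateCoding = record
  { encode = encodeState ; decode = lookup stateTable ; decode-encode = lookup-encodeState }

cellCoding : Coding Cell 13
cellCoding = record
  { encode = encodeCell ; decode = lookup cellTable ; decode-encode = lookup-encodeCell }

after : Operand → Scan
after opd₁ = num opd₂
after opd₂ = instr

-- Deterministic automaton for the words encSLP P: an instruction is an opcode other than 11
-- followed by two numbers, a number being digit pairs 1d terminated by 00.
scanNext : Scan → Bool → Maybe Scan
scanNext instr         false = just op-0
scanNext instr         true  = just op-1
scanNext op-0          _     = just (num opd₁)
scanNext op-1          false = just (num opd₁)
scanNext op-1          true  = nothing
scanNext (num a)       true  = just (num-digit a)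
scanNext (num a)       false = just (num-end a)
scanNext (num-digit a) _     = just (num a)
scanNext (num-end a)   false = just (after a)
scanNext (num-end a)   true  = nothing

-- The first bit of every instruction is marked; the mark's parity tells the counting passes
-- whether the instruction has been counted yet.
scanCell : Scan → Bool → Cell
scanCell instr b = mark true false b
scanCell _     b = bit b

parity : Pass → Bool
parity pass₀ = true
parity pass₁ = false
parity pass₂ = true
parity pass₃ = false

Action : Set
Action = Maybe (State × Cell × Move)

reject : Action
reject = just (reject₁ , bit true , right)

afterIncrement : Pass → Bool → State
afterIncrement p false = seek p
afterIncrement p true  = rewind p

seekMark : Pass → (wanted parity first b : Bool) → Action
seekMark p true  true  f b = just (toCounter p f , mark false f b , right)
seekMark p false false f b = just (toCounter p f , mark true f b , right)
seekMark p true  false f b = just (seek p , mark false f b , left)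
seekMark p false true  f b = just (seek p , mark true f b , left)

scanBit : Scan → Bool → Maybe Scan → Action
scanBit s b (just s′) = just (scanning s′ , scanCell s b , right)
scanBit s b nothing   = reject

-- After the input the machine writes  encOp minus ++ encℕ 0 ++ encℕ 0 ++ encOp minus,  then in each
-- of four passes the digits of a counter started at 1, 0, 2, 0 and incremented once per instruction,
-- each followed by the terminator 00 and, after the second pass, by encOp times. On rejection it
-- writes 11 followed by a digit cell, which is not a bit and so ends the output.
transition : State → Cell → Action
transition start ␣ = reject
transition start (bit false) = just (scanning op-0 , mark true true false , right)
transition start (bit true) = just (scanning op-1 , mark true true true , right)
transition start _ = nothing
transition (scanning s) (bit b) = scanBit s b (scanNext s b)
transition (scanning instr) ␣ = just (emit e01 , bit false , right)
transition (scanning _) ␣ = reject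
transition (scanning _) _ = nothing
transition reject₁ _ = just (reject₂ , bit true , right)
transition reject₂ _ = just (reject₃ , digit false , left)
transition reject₃ _ = just (halt , bit true , left)
transition halt _ = nothing
transition (emit e01) _ = just (emit e02 , bit true , right)
transition (emit e02) _ = just (emit e03 , bit false , right)
transition (emit e03) _ = just (emit e04 , bit false , right)
transition (emit e04) _ = just (emit e05 , bit false , right)
transition (emit e05) _ = just (emit e06 , bit false , right)
transition (emit e06) _ = just (emit e07 , bit false , right)
transition (emit e07) _ = just (emit e08 , bit true , right)
transition (emit e08) _ = just (emit e09 , digit true , right)
transition (emit e09) _ = just (seek pass₀ , digit true , left)
transition (emit e11) _ = just (seek pass₁ , bit false , left)
transition (emit e21) _ = just (emit e22 , bit false , right)
transition (emit e22) _ = just (emit e23 , bit true , right)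
transition (emit e23) _ = just (emit e24 , bit false , right)
transition (emit e24) _ = just (emit e25 , digit true , right)
transition (emit e25) _ = just (seek pass₂ , digit false , left)
transition (emit e31) _ = just (seek pass₃ , bit false , left)
transition (emit e41) _ = just (cleanup , bit false , left)
transition (seek p) (bit b) = just (seek p , bit b , left)
transition (seek p) (digit b) = just (seek p , digit b , left)
transition (seek p) (mark t f b) = seekMark p (parity p) t f b
transition (seek p) ␣ = nothing
transition (toCounter p f) (bit b) = just (toCounter p f , bit b , right)
transition (toCounter p f) (mark t f′ b) = just (toCounter p f , mark t f′ b , right)
transition (toCounter p f) (digit true) = just (carry p f , digit true , right)
transition (toCounter p f) ␣ = just (grow p f , digit true , right)
transition (toCounter p f) (digit false) = nothing
transition (carry p f) (digit true) = just (afterIncrement p f , digit false , left)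
transition (carry p f) (digit false) = just (toCounter p f , digit true , right)
transition (carry p f) _ = nothing
transition (grow p f) _ = just (afterIncrement p f , digit true , left)
transition (rewind p) (digit b) = just (rewind p , digit b , left)
transition (rewind p) (bit b) = just (flush p , bit b , right)
transition (rewind p) _ = nothing
transition (flush p) (digit b) = just (flush p , bit b , right)
transition (flush pass₀) ␣ = just (emit e11 , bit false , right)
transition (flush pass₁) ␣ = just (emit e21 , bit false , right)
transition (flush pass₂) ␣ = just (emit e31 , bit false , right)
transition (flush pass₃) ␣ = just (emit e41 , bit false , right)
transition (flush p) _ = nothing
transition cleanup (bit b) = just (cleanup , bit b , left)
transition cleanup (digit b) = just (cleanup , bit b , left)
transition cleanup (mark t false b) = just (cleanup , bit b , left)
transition cleanup (mark t true b) = just (halt , bit b , stay)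
transition cleanup ␣ = nothing

open FiniteMachine stateCoding cellCoding ␣ refl start transition

-- The reduction

accepting : Scan → Maybe (List Cell)
accepting instr = just []
accepting _     = nothing

-- The tape left behind by scanning w from state s, or nothing if w is rejected.
markInput : Scan → List Bool → Maybe (List Cell)
markInput s []      = accepting s
markInput s (b ∷ w) = scanNext s b >>= λ s′ → Maybe.map (scanCell s b ∷_) (markInput s′ w)

marks : List Cell → ℕ
marks []                = 0
marks (mark _ _ _ ∷ xs) = suc (marks xs)
marks (_ ∷ xs)          = marks xs

respond : List Bool → Maybe (List Cell) → List Bool
respond w (just W@(_ ∷ _)) = w ++ encSLP (negSquareSuffix (marks W))
respond w _                = true ∷ true ∷ []

-- The marks of the scanned input are exactly the instruction starts, so marks W counts the instructions.
reduce : List Bool → List Bool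
reduce w = respond w (markInput instr w)

markHead : List Bool → List Cell
markHead []       = []
markHead (b ∷ bs) = mark true false b ∷ map bit bs

markedSLP : SLP → List Cell
markedSLP [] = []
markedSLP ((o , j , k) ∷ P) = markHead (encOp o) ++ map bit (encℕ j) ++ map bit (encℕ k) ++ markedSLP P

private
  prepend₂ : Cell → Cell → Maybe (List Cell) → Maybe (List Cell)
  prepend₂ c c′ m = Maybe.map (c ∷_) (Maybe.map (c′ ∷_) m)

markInput-encℕᵇ : ∀ a x {rest W} → markInput (after a) rest ≡ just W →
  markInput (num a) (encℕᵇ x ++ rest) ≡ just (map bit (encℕᵇ x) ++ W)
markInput-encℕᵇ a zeroᵇ    eq = cong (prepend₂ (bit false) (bit false)) eq
markInput-encℕᵇ a 2[1+ x ] eq = cong (prepend₂ (bit true) (bit false)) (markInput-encℕᵇ a x eq)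
markInput-encℕᵇ a 1+[2 x ] eq = cong (prepend₂ (bit true) (bit true)) (markInput-encℕᵇ a x eq)

markInput-encSLP : ∀ P → markInput instr (encSLP P) ≡ just (markedSLP P)
markInput-encSLP [] = refl
markInput-encSLP ((o , j , k) ∷ P) =
  markInput-encOp o (markInput-encℕᵇ opd₁ (toℕᵇ j) (markInput-encℕᵇ opd₂ (toℕᵇ k) (markInput-encSLP P)))
  where
  markInput-encOp : ∀ o {rest W} → markInput (num opd₁) rest ≡ just W →
    markInput instr (encOp o ++ rest) ≡ just (markHead (encOp o) ++ W)
  markInput-encOp plus  eq = cong (prepend₂ (mark true false false) (bit false)) eq
  markInput-encOp minus eq = cong (prepend₂ (mark true false false) (bit true)) eq
  markInput-encOp times eq = cong (prepend₂ (mark true false true) (bit false)) eq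

pushDigit : Bool → ℕᵇ → ℕᵇ
pushDigit false x = 2[1+ x ]
pushDigit true  x = 1+[2 x ]

encℕᵇ-pushDigit : ∀ b x → encℕᵇ (pushDigit b x) ≡ true ∷ b ∷ encℕᵇ x
encℕᵇ-pushDigit false x = refl
encℕᵇ-pushDigit true  x = refl

markInput-num-sound : ∀ a w {W} → markInput (num a) w ≡ just W →
  Σ[ x ∈ ℕᵇ ] Σ[ rest ∈ List Bool ] Σ[ W′ ∈ List Cell ]
    w ≡ encℕᵇ x ++ rest × markInput (after a) rest ≡ just W′ × W ≡ map bit (encℕᵇ x) ++ W′
markInput-num-sound a (false ∷ false ∷ w) eq with markInput (after a) w in e
... | just W′ with refl ← eq = zeroᵇ , w , W′ , refl , e , refl
markInput-num-sound a (true ∷ b ∷ w) eq with markInput (num a) w in e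
... | just W₁ with refl ← eq with x , rest , W′ , refl , e′ , refl ← markInput-num-sound a w e =
  pushDigit b x , rest , W′ ,
  cong (_++ rest) (sym (encℕᵇ-pushDigit b x)) , e′ , cong (λ bs → map bit bs ++ W′) (sym (encℕᵇ-pushDigit b x))
markInput-num-sound a [] ()
markInput-num-sound a (false ∷ []) ()
markInput-num-sound a (false ∷ true ∷ _) ()
markInput-num-sound a (true ∷ []) ()

encℕ-toℕ : ∀ x → encℕ (toℕ x) ≡ encℕᵇ x
encℕ-toℕ x = cong encℕᵇ (fromℕ-toℕ x)

markInput-sound : ∀ w {W} → markInput instr w ≡ just W → Σ[ P ∈ SLP ] encSLP P ≡ w × markedSLP P ≡ W
markInput-sound w = sound (length w) w ≤-refl
  where
  -- The fuel n bounds the length of the input, which shrinks by a whole instruction per call.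
  sound : ∀ n w {W} → length w ≤ n → markInput instr w ≡ just W → Σ[ P ∈ SLP ] encSLP P ≡ w × markedSLP P ≡ W
  instruction : ∀ n o w {W} → length w ≤ n → markInput (num opd₁) w ≡ just W →
    Σ[ P ∈ SLP ] encSLP P ≡ encOp o ++ w × markedSLP P ≡ markHead (encOp o) ++ W

  sound n [] _ refl = [] , refl , refl
  sound (suc n) (false ∷ false ∷ w) (s≤s len) eq with markInput (num opd₁) w in e
  ... | just _ with refl ← eq = instruction n plus w (≤-trans (n≤1+n _) len) e
  sound (suc n) (false ∷ true ∷ w) (s≤s len) eq with markInput (num opd₁) w in e
  ... | just _ with refl ← eq = instruction n minus w (≤-trans (n≤1+n _) len) e
  sound (suc n) (true ∷ false ∷ w) (s≤s len) eq with markInput (num opd₁) w in e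
  ... | just _ with refl ← eq = instruction n times w (≤-trans (n≤1+n _) len) e
  sound n (false ∷ []) _ ()
  sound n (true ∷ []) _ ()
  sound (suc n) (true ∷ true ∷ _) _ ()

  instruction n o w len eq
    with x , rest₁ , _ , refl , eq₁ , refl ← markInput-num-sound opd₁ w eq
    with y , rest₂ , _ , refl , eq₂ , refl ← markInput-num-sound opd₂ rest₁ eq₁
    with P , refl , refl ← sound n rest₂ (≤-trans (length-++-≤ʳ rest₂ {encℕᵇ y})
                                         (≤-trans (length-++-≤ʳ (encℕᵇ y ++ rest₂) {encℕᵇ x}) len)) eq₂
    = (o , toℕ x , toℕ y) ∷ P ,
      cong (encOp o ++_) (cong₂ (λ a b → a ++ b ++ encSLP P) (encℕ-toℕ x) (encℕ-toℕ y)) ,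
      cong (markHead (encOp o) ++_) (cong₂ (λ a b → map bit a ++ map bit b ++ markedSLP P) (encℕ-toℕ x) (encℕ-toℕ y))

marks-bits : ∀ bs X → marks (map bit bs ++ X) ≡ marks X
marks-bits []       X = refl
marks-bits (b ∷ bs) X = marks-bits bs X

marks-markedSLP : ∀ P → marks (markedSLP P) ≡ length P
marks-markedSLP [] = refl
marks-markedSLP ((o , j , k) ∷ P) = trans (marks-markHead o)
  (cong suc (trans (marks-bits (encℕ j) _) (trans (marks-bits (encℕ k) _) (marks-markedSLP P))))
  where
  marks-markHead : ∀ o {X} → marks (markHead (encOp o) ++ X) ≡ suc (marks X)
  marks-markHead plus  = refl
  marks-markHead minus = refl
  marks-markHead times = refl

respond-just : ∀ w W → W ≢ [] → respond w (just W) ≡ w ++ encSLP (negSquareSuffix (marks W))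
respond-just w []      W≢[] with () ← W≢[] refl
respond-just w (_ ∷ _) _    = refl

markedSLP-∷≢[] : ∀ i P → markedSLP (i ∷ P) ≢ []
markedSLP-∷≢[] (plus  , _) P ()
markedSLP-∷≢[] (minus , _) P ()
markedSLP-∷≢[] (times , _) P ()

reduce-encSLP : ∀ P → P ≢ [] → reduce (encSLP P) ≡ encSLP (P ++ negSquareSuffix (length P))
reduce-encSLP [] P≢[] with () ← P≢[] refl
reduce-encSLP P@(i ∷ P′) _ rewrite markInput-encSLP P = begin
  respond (encSLP P) (just (markedSLP P))
    ≡⟨ respond-just (encSLP P) (markedSLP P) (markedSLP-∷≢[] i P′) ⟩
  encSLP P ++ encSLP (negSquareSuffix (marks (markedSLP P)))
    ≡⟨ cong (λ m → encSLP P ++ encSLP (negSquareSuffix m)) (marks-markedSLP P) ⟩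
  encSLP P ++ encSLP (negSquareSuffix (length P))
    ≡⟨ encSLP-++ P _ ⟨
  encSLP (P ++ negSquareSuffix (length P)) ∎
  where open ≡-Reasoning

reduce-sound : ∀ w Q → encSLP Q ≡ reduce w → Σ[ P ∈ SLP ] w ≡ encSLP P × Q ≡ P ++ negSquareSuffix (length P)
reduce-sound w Q eq with markInput instr w in e
... | nothing    with () ← encSLP≢11 Q eq
... | just []    with () ← encSLP≢11 Q eq
... | just (c ∷ W) with P , refl , marked ← markInput-sound w e =
  P , refl , encSLP-injective Q _ (begin
    encSLP Q                                                   ≡⟨ eq ⟩
    encSLP P ++ encSLP (negSquareSuffix (marks (c ∷ W)))       ≡⟨ cong (λ m → encSLP P ++ encSLP (negSquareSuffix m))
                                                                       (trans (cong marks (sym marked)) (marks-markedSLP P)) ⟩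
    encSLP P ++ encSLP (negSquareSuffix (length P))            ≡⟨ encSLP-++ P _ ⟨
    encSLP (P ++ negSquareSuffix (length P))                   ∎)
  where open ≡-Reasoning

value[]≢0 : value [] ≢ 0ℤ
value[]≢0 ()

EquSLP⇒3SoSSLP-reduce : ∀ w → EquSLP w → 3SoSSLP (reduce w)
EquSLP⇒3SoSSLP-reduce w (P , valid , refl , value≡0) =
  P ++ negSquareSuffix (length P) ,
  ValidFrom-++ 1 P _ valid (negSquareSuffix-valid (length P)) ,
  sym (reduce-encSLP P P≢[]) ,
  subst IsSumOf3Squares (sym value≡) 0-sumOf3Squares
  where
  P≢[] : P ≢ []
  P≢[] refl = value[]≢0 value≡0
  value≡ : value (P ++ negSquareSuffix (length P)) ≡ 0ℤ
  value≡ = trans (value-++-negSquareSuffix P) (cong (λ N → (0ℤ -ℤ N) *ℤ N) value≡0)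

3SoSSLP-reduce⇒EquSLP : ∀ w → 3SoSSLP (reduce w) → EquSLP w
3SoSSLP-reduce⇒EquSLP w (Q , valid , encQ , sos) with P , refl , refl ← reduce-sound w Q encQ =
  P , ValidFrom-++⁻ˡ 1 P _ valid , refl ,
  negSquare-sumOf3Squares⇒≡0 (value P) (subst IsSumOf3Squares (value-++-negSquareSuffix P) sos)

-- Scanning the input

firstOp : Bool → Scan
firstOp false = op-0
firstOp true  = op-1

reduce-∷ : ∀ b w → reduce (b ∷ w) ≡ respond (b ∷ w) (Maybe.map (mark true false b ∷_) (markInput (firstOp b) w))
reduce-∷ false w = refl
reduce-∷ true  w = refl

transition-start : ∀ b → transition start (bit b) ≡ just (scanning (firstOp b) , mark true true b , right)
transition-start false = refl
transition-start true  = refl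

initConf-∷ : ∀ b w → initConf machine (b ∷ w) ≡ ⟪ start ∣ [] ∣ map bit (b ∷ w) ⟫
initConf-∷ b w = cong₂ (conf (encodeState start) []) (bitSym-encodeCell b) (trans (map-cong bitSym-encodeCell w) (map-∘ w))
  where
  bitSym-encodeCell : ∀ b → bitSym machine b ≡ encodeCell (bit b)
  bitSym-encodeCell false = refl
  bitSym-encodeCell true  = refl

reject-halts : ∀ q L R → transition q (head R) ≡ reject → Halts ⟪ q ∣ L ∣ R ⟫ 4 (true ∷ true ∷ [])
reject-halts q L R eq =
  ⟪ halt ∣ L ∣ bit true ∷ bit true ∷ digit false ∷ tail (tail (tail R)) ⟫ ,
  ↝-trans (stepR {q} {L} {R} eq)
   (↝-trans (stepR {reject₁} {bit true ∷ L} {tail R} refl)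
    (↝-trans (stepL {reject₂} {bit true} {bit true ∷ L} {tail (tail R)} refl)
     (stepL {reject₃} {bit true} {L} {bit true ∷ digit false ∷ tail (tail (tail R))} refl))) ,
  stepHalt {halt} {L} {bit true ∷ bit true ∷ digit false ∷ tail (tail (tail R))} refl ,
  refl

scan-accepts : ∀ s w {L W} → markInput s w ≡ just W →
  ⟪ scanning s ∣ L ∣ map bit w ⟫ ↝[ length w ] ⟪ scanning instr ∣ W ʳ++ L ∣ [] ⟫
scan-accepts instr [] refl = ↝-refl
scan-accepts s (b ∷ w) {L} eq with scanNext s b in e
... | just s′ with markInput s′ w in e′
...   | just W′ with refl ← eq =
  ↝-trans (stepR {scanning s} {L} {map bit (b ∷ w)} (cong (scanBit s b) e)) (scan-accepts s′ w e′)

scan-rejects : ∀ s w {L} → markInput s w ≡ nothing →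
  Halts ⟪ scanning s ∣ L ∣ map bit w ⟫ (length w + 4) (true ∷ true ∷ [])
scan-rejects op-0          [] {L} _ = reject-halts (scanning op-0) L [] refl
scan-rejects op-1          [] {L} _ = reject-halts (scanning op-1) L [] refl
scan-rejects (num a)       [] {L} _ = reject-halts (scanning (num a)) L [] refl
scan-rejects (num-digit a) [] {L} _ = reject-halts (scanning (num-digit a)) L [] refl
scan-rejects (num-end a)   [] {L} _ = reject-halts (scanning (num-end a)) L [] refl
scan-rejects s (b ∷ w) {L} eq with scanNext s b in e
... | nothing = Halts-weaken (m≤n+m 4 (suc (length w)))
                  (reject-halts (scanning s) L (map bit (b ∷ w)) (cong (scanBit s b) e))
... | just s′ with markInput s′ w in e′
...   | nothing = ↝-Halts (stepR {scanning s} {L} {map bit (b ∷ w)} (cong (scanBit s b) e))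
                         (scan-rejects s′ w {scanCell s b ∷ L} e′)

cellBit : Cell → Bool
cellBit ␣            = false
cellBit (bit b)      = b
cellBit (mark _ _ b) = b
cellBit (digit b)    = b

cellBit-scanCell : ∀ s b → cellBit (scanCell s b) ≡ b
cellBit-scanCell instr         b = refl
cellBit-scanCell op-0          b = refl
cellBit-scanCell op-1          b = refl
cellBit-scanCell (num _)       b = refl
cellBit-scanCell (num-digit _) b = refl
cellBit-scanCell (num-end _)   b = refl

markInput-cellBits : ∀ s w {W} → markInput s w ≡ just W → map cellBit W ≡ w
markInput-cellBits instr [] refl = refl
markInput-cellBits s (b ∷ w) eq with scanNext s b
... | just s′ with markInput s′ w in e
...   | just W′ with refl ← eq = cong₂ _∷_ (cellBit-scanCell s b) (markInput-cellBits s′ w e)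

-- Counting passes

-- Digits of x in bijective base 2, least significant first, digit 1 written 11 and digit 2 written 10.
digitsᵇ : ℕᵇ → List Bool
digitsᵇ zeroᵇ    = []
digitsᵇ 2[1+ x ] = true ∷ false ∷ digitsᵇ x
digitsᵇ 1+[2 x ] = true ∷ true ∷ digitsᵇ x

counter : ℕᵇ → List Cell
counter x = map digit (digitsᵇ x)

counterℕ : ℕ → List Cell
counterℕ v = counter (fromℕ' v)

digitsℕ : ℕ → List Bool
digitsℕ v = digitsᵇ (fromℕ' v)

length-digitsᵇ-suc : ∀ x → length (digitsᵇ (sucᵇ x)) ≤ 2 + length (digitsᵇ x)
length-digitsᵇ-suc zeroᵇ    = ≤-refl
length-digitsᵇ-suc 2[1+ x ] = s≤s (s≤s (length-digitsᵇ-suc x))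
length-digitsᵇ-suc 1+[2 x ] = s≤s (s≤s (m≤n+m _ 2))

length-digitsℕ : ∀ v → length (digitsℕ v) ≤ 2 * v
length-digitsℕ zero    = z≤n
length-digitsℕ (suc v) = ≤-trans (length-digitsᵇ-suc (fromℕ' v))
  (≤-trans (+-monoʳ-≤ 2 (length-digitsℕ v))
           (≤-reflexive (solve-ℕ 1 (λ v → con 2 :+ con 2 :* v := con 2 :* (con 1 :+ v)) refl v)))

length-counterℕ : ∀ v → length (counterℕ v) ≤ 2 * v
length-counterℕ v = ≤-trans (≤-reflexive (length-map digit (digitsℕ v))) (length-digitsℕ v)

-- A position of the head on one of the cells of xs.
Inside : List Cell → Set
Inside xs = Σ[ X ∈ List Cell ] Σ[ r ∈ Cell ] Σ[ R ∈ List Cell ] X ++ r ∷ R ≡ xs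

-- L lists the cells left of xs, nearest first.
⟪_∣_∣_⟫ᵢ : ∀ {xs} → State → List Cell → Inside xs → Config machine
⟪ q ∣ L ∣ X , r , R , _ ⟫ᵢ = ⟪ q ∣ X ʳ++ L ∣ r ∷ R ⟫

Inside-++ˡ : ∀ Y {xs} → Inside xs → Inside (Y ++ xs)
Inside-++ˡ Y (X , r , R , eq) = Y ++ X , r , R , trans (++-assoc Y X (r ∷ R)) (cong (Y ++_) eq)

⟪⟫ᵢ-++ˡ : ∀ q L Y {xs} (s : Inside xs) → ⟪ q ∣ L ∣ Inside-++ˡ Y s ⟫ᵢ ≡ ⟪ q ∣ Y ʳ++ L ∣ s ⟫ᵢ
⟪⟫ᵢ-++ˡ q L Y (X , r , R , _) = cong (λ L′ → ⟪ q ∣ L′ ∣ r ∷ R ⟫) (++-ʳ++ Y)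

length-prefix : ∀ {A : Set} (X : List A) {r R xs} → X ++ r ∷ R ≡ xs → length X ≤ length xs
length-prefix X eq = ≤-trans (length-++-≤ˡ X) (≤-reflexive (cong length eq))

increment : ∀ p f x L → Σ[ s ∈ Inside (counter (sucᵇ x)) ]
  ⟪ toCounter p f ∣ L ∣ counter x ⟫ ↝[ length (counter x) + 2 ] ⟪ afterIncrement p f ∣ L ∣ s ⟫ᵢ
increment p f zeroᵇ L =
  ([] , digit true , digit true ∷ [] , refl) ,
  ↝-trans (stepR {toCounter p f} {L} {[]} refl) (stepL {grow p f} {digit true} {L} {[]} refl)
increment p f 2[1+ x ] L with s , run ← increment p f x (digit true ∷ digit true ∷ L) =
  Inside-++ˡ (digit true ∷ digit true ∷ []) s ,
  ↝-trans (stepR {toCounter p f} {L} {counter 2[1+ x ]} refl)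
    (↝-trans (stepR {carry p f} {digit true ∷ L} {digit false ∷ counter x} refl) run)
increment p f 1+[2 x ] L =
  ([] , digit true , digit false ∷ counter x , refl) ,
  ↝-weaken (s≤s (s≤s z≤n))
    (↝-trans (stepR {toCounter p f} {L} {counter 1+[2 x ]} refl)
             (stepL {carry p f} {digit true} {L} {digit true ∷ counter x} refl))

data Pending (p : Pass) : Cell → Set where
  pending-bit  : ∀ b → Pending p (bit b)
  pending-mark : ∀ b → Pending p (mark (parity p) false b)

data Done (p : Pass) : Cell → Set where
  done-bit  : ∀ b → Done p (bit b)
  done-mark : ∀ b → Done p (mark (not (parity p)) false b)

flipMark : Cell → Cell
flipMark (mark t f b) = mark (not t) f b
flipMark c            = c

scanCell-pending : ∀ s b → Pending pass₀ (scanCell s b)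
scanCell-pending instr         b = pending-mark b
scanCell-pending op-0          b = pending-bit b
scanCell-pending op-1          b = pending-bit b
scanCell-pending (num _)       b = pending-bit b
scanCell-pending (num-digit _) b = pending-bit b
scanCell-pending (num-end _)   b = pending-bit b

markInput-pending : ∀ s w {W} → markInput s w ≡ just W → All (Pending pass₀) W
markInput-pending instr [] refl = []
markInput-pending s (b ∷ w) eq with scanNext s b
... | just s′ with markInput s′ w in e
...   | just W′ with refl ← eq = scanCell-pending s b ∷ markInput-pending s′ w e

seek-skips-done : ∀ p {c} → Done p c → SweepsLeft (seek p) id c
seek-skips-done p     (done-bit b)  = refl
seek-skips-done pass₀ (done-mark b) = refl
seek-skips-done pass₁ (done-mark b) = refl
seek-skips-done pass₂ (done-mark b) = refl
seek-skips-done pass₃ (done-mark b) = refl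

seek-skips-bits : ∀ p bs → All (SweepsLeft (seek p) id) (map bit bs)
seek-skips-bits p bs = map⁺ (All.tabulate {xs = bs} (λ _ → refl))

seek-skips-counter : ∀ p x → All (SweepsLeft (seek p) id) (counter x)
seek-skips-counter p x = map⁺ (All.tabulate {xs = digitsᵇ x} (λ _ → refl))

seek-counts : ∀ p f b → transition (seek p) (mark (parity p) f b) ≡ just (toCounter p f , mark (not (parity p)) f b , right)
seek-counts pass₀ f b = refl
seek-counts pass₁ f b = refl
seek-counts pass₂ f b = refl
seek-counts pass₃ f b = refl

toCounter-skips-done : ∀ p f {c} → Done p c → SweepsRight (toCounter p f) id c
toCounter-skips-done p f (done-bit b)  = refl
toCounter-skips-done p f (done-mark b) = refl

toCounter-skips-bits : ∀ p f bs → All (SweepsRight (toCounter p f) id) (map bit bs)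
toCounter-skips-bits p f bs = map⁺ (All.tabulate {xs = bs} (λ _ → refl))

-- One round of a pass: seek the nearest pending mark to the left, flip it, and increment the counter.
countMark : ∀ p f b v Bk zs L (s : Inside ((Bk ++ map bit zs) ++ counterℕ v)) → All (Done p) Bk →
  Σ[ s′ ∈ Inside (counterℕ (suc v)) ]
    ⟪ seek p ∣ mark (parity p) f b ∷ L ∣ s ⟫ᵢ
      ↝[ 2 * length ((Bk ++ map bit zs) ++ counterℕ v) + 4 ]
    ⟪ afterIncrement p f ∣ (Bk ++ map bit zs) ʳ++ (mark (not (parity p)) f b ∷ L) ∣ s′ ⟫ᵢ
countMark p f b v Bk zs L (X , r , R , eq) done
  with s′ , inc ← increment p f (fromℕ' v) ((Bk ++ map bit zs) ʳ++ (mark (not (parity p)) f b ∷ L)) =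
  s′ , ↝-weaken bound
    (↝-trans (skipLeft X (++⁻ˡ X skips) (All.head (++⁻ʳ X skips)))
    (↝-trans (stepR {seek p} {L} {mark (parity p) f b ∷ X ++ r ∷ R} (seek-counts p f b))
    (↝-cast (cong (λ T → ⟪ toCounter p f ∣ mark (not (parity p)) f b ∷ L ∣ T ⟫) (sym eq)) refl
    (↝-trans (skipRight Y (++⁺ (All.map (toCounter-skips-done p f) done) (toCounter-skips-bits p f zs))) inc))))
  where
  Y = Bk ++ map bit zs
  C = counterℕ v
  skips : All (SweepsLeft (seek p) id) (X ++ r ∷ R)
  skips = subst (All _) (sym eq)
    (++⁺ (++⁺ (All.map (seek-skips-done p) done) (seek-skips-bits p zs)) (seek-skips-counter p (fromℕ' v)))
  bound : suc (length X) + (1 + (length Y + (length C + 2))) ≤ 2 * length (Y ++ C) + 4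
  bound = ≤-trans (+-monoˡ-≤ _ (s≤s (length-prefix X eq)))
    (≤-reflexive (trans (cong (λ n → suc (length (Y ++ C)) + (1 + n))
                              (trans (sym (+-assoc (length Y) (length C) 2)) (cong (_+ 2) (sym (length-++ Y)))))
                        (solve-ℕ 1 (λ a → (con 1 :+ a) :+ (con 1 :+ (a :+ con 2)) := con 2 :* a :+ con 4)
                                 refl (length (Y ++ C)))))

-- Bounds the length of the tape right of the pending cells during the rest of a pass.
budget : List Cell → List Cell → List Bool → ℕ → ℕ
budget Frʳ Bk zs v = length Frʳ + length Bk + length zs + 2 * suc (marks Frʳ + v)

budget-bit : ∀ c Frʳ Bk zs v → budget (bit c ∷ Frʳ) Bk zs v ≡ budget Frʳ (bit c ∷ Bk) zs v
budget-bit c Frʳ Bk zs v = cong (λ n → n + length zs + 2 * suc (marks Frʳ + v)) (sym (+-suc (length Frʳ) (length Bk)))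

budget-mark : ∀ t c c′ Frʳ Bk zs v → budget (mark t false c ∷ Frʳ) Bk zs v ≡ budget Frʳ (c′ ∷ Bk) zs (suc v)
budget-mark t c c′ Frʳ Bk zs v =
  cong₂ (λ n m → n + length zs + 2 * suc m) (sym (+-suc (length Frʳ) (length Bk))) (sym (+-suc (marks Frʳ) v))

length-tape≤budget : ∀ Frʳ Bk zs v → length ((Bk ++ map bit zs) ++ counterℕ v) ≤ budget Frʳ Bk zs v
length-tape≤budget Frʳ Bk zs v = begin
  length ((Bk ++ map bit zs) ++ counterℕ v)         ≡⟨ length-++ (Bk ++ map bit zs) ⟩
  length (Bk ++ map bit zs) + length (counterℕ v)
    ≡⟨ cong (_+ length (counterℕ v)) (trans (length-++ Bk) (cong (length Bk +_) (length-map bit zs))) ⟩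
  length Bk + length zs + length (counterℕ v)       ≤⟨ +-monoʳ-≤ (length Bk + length zs) counter≤ ⟩
  length Bk + length zs + 2 * suc (marks Frʳ + v)   ≤⟨ m≤n+m _ (length Frʳ) ⟩
  length Frʳ + (length Bk + length zs + 2 * suc (marks Frʳ + v))
    ≡⟨ trans (sym (+-assoc (length Frʳ) _ _))
             (cong (_+ 2 * suc (marks Frʳ + v)) (sym (+-assoc (length Frʳ) (length Bk) (length zs)))) ⟩
  budget Frʳ Bk zs v ∎
  where
  open ≤-Reasoning
  counter≤ : length (counterℕ v) ≤ 2 * suc (marks Frʳ + v)
  counter≤ = ≤-trans (length-counterℕ v) (*-monoʳ-≤ 2 (≤-trans (m≤n+m v (marks Frʳ)) (n≤1+n _)))

-- Frʳ lists the pending cells from right to left; the first mark of the input lies left of them all.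
countMarks : ∀ p b M Frʳ Bk zs v → All (Pending p) Frʳ → All (Done p) Bk → budget Frʳ Bk zs v ≤ M →
  (s : Inside ((Bk ++ map bit zs) ++ counterℕ v)) →
  Σ[ s′ ∈ Inside (counterℕ (suc (marks Frʳ + v))) ]
    ⟪ seek p ∣ Frʳ ++ mark (parity p) true b ∷ [] ∣ s ⟫ᵢ
      ↝[ suc (length Frʳ) * (2 * M + 4) ]
    ⟪ rewind p ∣ (Bk ++ map bit zs) ʳ++ (map flipMark Frʳ ++ mark (not (parity p)) true b ∷ []) ∣ s′ ⟫ᵢ
countMarks p b M [] Bk zs v [] done fits s
  with s′ , run ← countMark p true b v Bk zs [] s done =
  s′ , ↝-weaken (≤-trans (+-monoˡ-≤ 4 (*-monoʳ-≤ 2 (≤-trans (length-tape≤budget [] Bk zs v) fits))) (m≤m+n _ 0))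
                run
countMarks p b M (bit c ∷ Frʳ) Bk zs v (pending-bit c ∷ pending) done fits s
  with s′ , run ← countMarks p b M Frʳ (bit c ∷ Bk) zs v pending (done-bit c ∷ done)
                    (subst (_≤ M) (budget-bit c Frʳ Bk zs v) fits) (Inside-++ˡ (bit c ∷ []) s) =
  s′ , ↝-weaken (m≤n+m _ (2 * M + 4)) run
countMarks p b M (mark t false c ∷ Frʳ) Bk zs v (pending-mark c ∷ pending) done fits s
  with s₁ , run₁ ← countMark p false c v Bk zs (Frʳ ++ mark (parity p) true b ∷ []) s done
  with s′ , run₂ ← countMarks p b M Frʳ (mark (not (parity p)) false c ∷ Bk) zs (suc v) pending (done-mark c ∷ done)
                     (subst (_≤ M) (budget-mark (parity p) c (mark (not (parity p)) false c) Frʳ Bk zs v) fits)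
                     (Inside-++ˡ (mark (not (parity p)) false c ∷ Bk ++ map bit zs) s₁) =
  subst Goal (+-suc (marks Frʳ) v)
    (s′ , ↝-weaken time
            (↝-trans run₁ (↝-cast (⟪⟫ᵢ-++ˡ (seek p) (Frʳ ++ F ∷ []) (mark (not (parity p)) false c ∷ Bk ++ map bit zs) s₁)
                                  refl run₂)))
  where
  F = mark (parity p) true b
  K = 2 * M + 4
  target : ∀ n → Inside (counterℕ n) → Config machine
  target _ s′ =
    ⟪ rewind p ∣ (Bk ++ map bit zs) ʳ++ (map flipMark (mark t false c ∷ Frʳ) ++ mark (not (parity p)) true b ∷ []) ∣ s′ ⟫ᵢ
  Goal : ℕ → Set
  Goal n = Σ[ s′ ∈ Inside (counterℕ (suc n)) ]
    ⟪ seek p ∣ mark t false c ∷ Frʳ ++ F ∷ [] ∣ s ⟫ᵢ ↝[ suc (suc (length Frʳ)) * K ] target (suc n) s′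
  time : 2 * length ((Bk ++ map bit zs) ++ counterℕ v) + 4 + suc (length Frʳ) * K ≤ suc (suc (length Frʳ)) * K
  time = +-monoˡ-≤ _ (+-monoˡ-≤ 4 (*-monoʳ-≤ 2 (≤-trans (length-tape≤budget (mark t false c ∷ Frʳ) Bk zs v) fits)))

digitToBit : Cell → Cell
digitToBit (digit b) = bit b
digitToBit c         = c

rewind-skips-counter : ∀ p x → All (SweepsLeft (rewind p) id) (counter x)
rewind-skips-counter p x = map⁺ (All.tabulate {xs = digitsᵇ x} (λ _ → refl))

flush-converts-counter : ∀ p x → All (SweepsRight (flush p) digitToBit) (counter x)
flush-converts-counter p x = map⁺ (All.tabulate {xs = digitsᵇ x} (λ _ → refl))

finishPass : ∀ p z L x (s : Inside (counter x)) →
  ⟪ rewind p ∣ bit z ∷ L ∣ s ⟫ᵢ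
    ↝[ 2 * length (counter x) + 2 ]
  ⟪ flush p ∣ map bit (digitsᵇ x) ʳ++ (bit z ∷ L) ∣ [] ⟫
finishPass p z L x (C₁ , c , C₂ , eq) = ↝-weaken time
  (↝-trans (skipLeft C₁ (++⁻ˡ C₁ skips) (All.head (++⁻ʳ C₁ skips)))
  (↝-trans (stepR {rewind p} {L} {bit z ∷ C₁ ++ c ∷ C₂} refl)
  (↝-cast (cong (λ T → ⟪ flush p ∣ bit z ∷ L ∣ T ⟫) (trans (++-identityʳ (counter x)) (sym eq)))
          (cong (λ T → ⟪ flush p ∣ T ʳ++ (bit z ∷ L) ∣ [] ⟫) (sym (map-∘ (digitsᵇ x))))
          (sweepRight (counter x) (flush-converts-counter p x)))))
  where
  skips : All (SweepsLeft (rewind p) id) (C₁ ++ c ∷ C₂)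
  skips = subst (All _) (sym eq) (rewind-skips-counter p x)
  time : suc (length C₁) + (1 + length (counter x)) ≤ 2 * length (counter x) + 2
  time = ≤-trans (+-monoˡ-≤ _ (s≤s (length-prefix C₁ eq)))
    (≤-reflexive (solve-ℕ 1 (λ l → con 1 :+ l :+ (con 1 :+ l) := con 2 :* l :+ con 2) refl (length (counter x))))

bits-ʳ++ : ∀ (xs ys : List Bool) (K : List Cell) → map bit ys ʳ++ (map bit xs ʳ++ K) ≡ map bit (xs ++ ys) ʳ++ K
bits-ʳ++ xs ys K = trans (sym (++-ʳ++ (map bit xs))) (cong (_ʳ++ K) (sym (map-++ bit xs ys)))

passTime : ℕ → ℕ → ℕ
passTime a M = suc a * (2 * M + 4) + (2 * M + 2)

pass : ∀ p b M Frʳ k zs z v → All (Pending p) Frʳ → marks Frʳ ≡ k → budget Frʳ [] (zs ++ z ∷ []) v ≤ M →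
  (s : Inside (map bit (zs ++ z ∷ []) ++ counterℕ v)) →
  ⟪ seek p ∣ Frʳ ++ mark (parity p) true b ∷ [] ∣ s ⟫ᵢ
    ↝[ passTime (length Frʳ) M ]
  ⟪ flush p ∣ map bit ((zs ++ z ∷ []) ++ digitsℕ (v + suc k)) ʳ++ (map flipMark Frʳ ++ mark (not (parity p)) true b ∷ [])
          ∣ [] ⟫
pass p b M Frʳ k zs z v pending refl fits s
  with s′ , run ← countMarks p b M Frʳ [] (zs ++ z ∷ []) v pending [] fits s =
  ↝-trans run (↝-cast source target
    (↝-weaken (+-monoˡ-≤ 2 (*-monoʳ-≤ 2 counter≤M)) (finishPass p z (map bit zs ʳ++ K) _ s′)))
  where
  K = map flipMark Frʳ ++ mark (not (parity p)) true b ∷ []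
  ds = digitsℕ (v + suc (marks Frʳ))
  source : ⟪ rewind p ∣ bit z ∷ map bit zs ʳ++ K ∣ s′ ⟫ᵢ
         ≡ ⟪ rewind p ∣ map bit (zs ++ z ∷ []) ʳ++ K ∣ s′ ⟫ᵢ
  source = cong (λ L → ⟪ rewind p ∣ L ∣ s′ ⟫ᵢ) (bits-ʳ++ zs (z ∷ []) K)
  target : ⟪ flush p ∣ map bit (digitsℕ (suc (marks Frʳ + v))) ʳ++ (bit z ∷ map bit zs ʳ++ K) ∣ [] ⟫
         ≡ ⟪ flush p ∣ map bit ((zs ++ z ∷ []) ++ ds) ʳ++ K ∣ [] ⟫
  target = cong (λ L → ⟪ flush p ∣ L ∣ [] ⟫) (begin
    map bit (digitsℕ (suc (marks Frʳ + v))) ʳ++ (bit z ∷ map bit zs ʳ++ K)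
      ≡⟨ cong (λ n → map bit (digitsℕ n) ʳ++ (bit z ∷ map bit zs ʳ++ K)) (+-comm (suc (marks Frʳ)) v) ⟩
    map bit ds ʳ++ (map bit (z ∷ []) ʳ++ (map bit zs ʳ++ K))
      ≡⟨ cong (map bit ds ʳ++_) (bits-ʳ++ zs (z ∷ []) K) ⟩
    map bit ds ʳ++ (map bit (zs ++ z ∷ []) ʳ++ K)
      ≡⟨ bits-ʳ++ (zs ++ z ∷ []) ds K ⟩
    map bit ((zs ++ z ∷ []) ++ ds) ʳ++ K ∎)
    where open ≡-Reasoning
  counter≤M : length (counterℕ (suc (marks Frʳ + v))) ≤ M
  counter≤M = ≤-trans (length-counterℕ (suc (marks Frʳ + v))) (≤-trans (m≤n+m _ _) fits)

pending-flipMark : ∀ {p p′ c} → parity p′ ≡ not (parity p) → Pending p c → Pending p′ (flipMark c)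
pending-flipMark _ (pending-bit b) = pending-bit b
pending-flipMark {p′ = p′} eq (pending-mark b) = subst (λ t → Pending p′ (mark t false b)) eq (pending-mark b)

pending-flip : ∀ {p p′ xs} → parity p′ ≡ not (parity p) → All (Pending p) xs → All (Pending p′) (map flipMark xs)
pending-flip eq pending = map⁺ (All.map (pending-flipMark eq) pending)

cellBit-flipMark : ∀ c → cellBit (flipMark c) ≡ cellBit c
cellBit-flipMark ␣            = refl
cellBit-flipMark (bit _)      = refl
cellBit-flipMark (mark _ _ _) = refl
cellBit-flipMark (digit _)    = refl

cellBits-flipMark : ∀ xs → map cellBit (map flipMark xs) ≡ map cellBit xs
cellBits-flipMark xs = trans (sym (map-∘ xs)) (map-cong cellBit-flipMark xs)

marks-flipMark : ∀ xs → marks (map flipMark xs) ≡ marks xs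
marks-flipMark []                = refl
marks-flipMark (␣ ∷ xs)          = marks-flipMark xs
marks-flipMark (bit _ ∷ xs)      = marks-flipMark xs
marks-flipMark (mark _ _ _ ∷ xs) = cong suc (marks-flipMark xs)
marks-flipMark (digit _ ∷ xs)    = marks-flipMark xs

flip⁴ : List Cell → List Cell
flip⁴ = map flipMark ∘ map flipMark ∘ map flipMark ∘ map flipMark

flip⁴-invariant : ∀ {A : Set} (f : List Cell → A) → (∀ ys → f (map flipMark ys) ≡ f ys) →
  ∀ xs → f (flip⁴ xs) ≡ f xs
flip⁴-invariant f invariant xs =
  trans (invariant (map flipMark (map flipMark (map flipMark xs))))
  (trans (invariant (map flipMark (map flipMark xs))) (trans (invariant (map flipMark xs)) (invariant xs)))

marks-ʳ++ : ∀ xs ys → marks (xs ʳ++ ys) ≡ marks xs + marks ys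
marks-ʳ++ []                ys = refl
marks-ʳ++ (␣ ∷ xs)          ys = marks-ʳ++ xs (␣ ∷ ys)
marks-ʳ++ (bit b ∷ xs)      ys = marks-ʳ++ xs (bit b ∷ ys)
marks-ʳ++ (mark t f b ∷ xs) ys = trans (marks-ʳ++ xs (mark t f b ∷ ys)) (+-suc (marks xs) (marks ys))
marks-ʳ++ (digit b ∷ xs)    ys = marks-ʳ++ xs (digit b ∷ ys)

marks≤length : ∀ xs → marks xs ≤ length xs
marks≤length []                = z≤n
marks≤length (␣ ∷ xs)          = ≤-trans (marks≤length xs) (n≤1+n _)
marks≤length (bit _ ∷ xs)      = ≤-trans (marks≤length xs) (n≤1+n _)
marks≤length (mark _ _ _ ∷ xs) = s≤s (marks≤length xs)
marks≤length (digit _ ∷ xs)    = ≤-trans (marks≤length xs) (n≤1+n _)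

-- The whole run

-- Together with the bit 1 that follows, these spell  encOp minus ++ encℕ 0 ++ encℕ 0 ++ encOp minus.
bits₀ : List Bool
bits₀ = false ∷ true ∷ false ∷ false ∷ false ∷ false ∷ false ∷ []

start₀ : Inside (map bit (bits₀ ++ true ∷ []) ++ counterℕ 1)
start₀ = map bit (bits₀ ++ true ∷ []) , digit true , digit true ∷ [] , refl

emit-pass₀ : ∀ L → ⟪ scanning instr ∣ L ∣ [] ⟫ ↝[ 10 ] ⟪ seek pass₀ ∣ L ∣ start₀ ⟫ᵢ
emit-pass₀ L = 10 , ≤-refl , refl

startAfter00 : ∀ ys → Inside (map bit ((ys ++ false ∷ []) ++ false ∷ []) ++ counterℕ 0)
startAfter00 ys = map bit ys , bit false , bit false ∷ [] ,
  trans (sym (map-++ bit ys (false ∷ false ∷ [])))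
        (trans (cong (map bit) (sym (++-assoc ys (false ∷ []) (false ∷ [])))) (sym (++-identityʳ _)))

emit-pass₁ : ∀ ys L →
  ⟪ flush pass₀ ∣ map bit ys ʳ++ L ∣ [] ⟫ ↝[ 2 ] ⟪ seek pass₁ ∣ L ∣ startAfter00 ys ⟫ᵢ
emit-pass₁ ys L = 2 , ≤-refl , refl

start₂ : ∀ ys → Inside (map bit ((ys ++ false ∷ false ∷ true ∷ []) ++ false ∷ []) ++ counterℕ 2)
start₂ ys = map bit ((ys ++ false ∷ false ∷ true ∷ []) ++ false ∷ []) , digit true , digit false ∷ [] , refl

emit-pass₂ : ∀ ys L →
  ⟪ flush pass₁ ∣ map bit ys ʳ++ L ∣ [] ⟫ ↝[ 6 ] ⟪ seek pass₂ ∣ L ∣ start₂ ys ⟫ᵢ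
emit-pass₂ ys L = ↝-cast refl
  (cong (λ K → ⟪ seek pass₂ ∣ K ∣ digit true ∷ digit false ∷ [] ⟫)
        (trans (bits-ʳ++ ys (false ∷ false ∷ true ∷ false ∷ []) L)
               (cong (λ zs → map bit zs ʳ++ L) (sym (++-assoc ys (false ∷ false ∷ true ∷ []) (false ∷ []))))))
  (6 , ≤-refl , refl)

emit-pass₃ : ∀ ys L →
  ⟪ flush pass₂ ∣ map bit ys ʳ++ L ∣ [] ⟫ ↝[ 2 ] ⟪ seek pass₃ ∣ L ∣ startAfter00 ys ⟫ᵢ
emit-pass₃ ys L = 2 , ≤-refl , refl

emit-cleanup : ∀ L → ⟪ flush pass₃ ∣ L ∣ [] ⟫ ↝[ 2 ] ⟪ cleanup ∣ L ∣ bit false ∷ bit false ∷ [] ⟫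
emit-cleanup L = 2 , ≤-refl , refl

-- The bits on the tape after the input just before each pass; pass i then appends the digits
-- of m + 1, m, m + 2, m.
written₀ written₁ written₂ written₃ suffixBits : ℕ → List Bool
written₀ m = bits₀ ++ true ∷ []
written₁ m = ((written₀ m ++ digitsℕ (suc m)) ++ false ∷ []) ++ false ∷ []
written₂ m = ((written₁ m ++ digitsℕ m) ++ false ∷ false ∷ true ∷ []) ++ false ∷ []
written₃ m = ((written₂ m ++ digitsℕ (suc (suc m))) ++ false ∷ []) ++ false ∷ []
suffixBits m = written₃ m ++ digitsℕ m

encℕ-digitsℕ : ∀ n R → encℕ n ++ R ≡ digitsℕ n ++ false ∷ false ∷ R
encℕ-digitsℕ n R = trans (cong (λ x → encℕᵇ x ++ R) (fromℕ≡fromℕ' n)) (encℕᵇ-digitsᵇ (fromℕ' n))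
  where
  encℕᵇ-digitsᵇ : ∀ x → encℕᵇ x ++ R ≡ digitsᵇ x ++ false ∷ false ∷ R
  encℕᵇ-digitsᵇ zeroᵇ    = refl
  encℕᵇ-digitsᵇ 2[1+ x ] = cong (λ bs → true ∷ false ∷ bs) (encℕᵇ-digitsᵇ x)
  encℕᵇ-digitsᵇ 1+[2 x ] = cong (λ bs → true ∷ true ∷ bs) (encℕᵇ-digitsᵇ x)

suffixBits-encSLP : ∀ m → suffixBits m ++ false ∷ false ∷ [] ≡ encSLP (negSquareSuffix m)
suffixBits-encSLP m = begin
  suffixBits m ++ false ∷ false ∷ []
    ≡⟨ reassociate bits₀ (true ∷ []) (digitsℕ (suc m)) (false ∷ []) (digitsℕ m) (false ∷ false ∷ true ∷ [])
                   (digitsℕ (suc (suc m))) (false ∷ false ∷ []) ⟩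
  bits₀ ++ true ∷ digitsℕ (suc m) ++ false ∷ false ∷ digitsℕ m ++ false ∷ false ∷ true ∷ false ∷
    digitsℕ (suc (suc m)) ++ false ∷ false ∷ digitsℕ m ++ false ∷ false ∷ []
    ≡⟨ cong (bits₀ ++_) (cong (true ∷_) (sym (encSLP-digits))) ⟩
  encSLP (negSquareSuffix m) ∎
  where
  open ≡-Reasoning
  reassociate : ∀ (a t d₁ f d₂ f001 d₃ ff : List Bool) →
    (((((((((((a ++ t) ++ d₁) ++ f) ++ f) ++ d₂) ++ f001) ++ f) ++ d₃) ++ f) ++ f) ++ d₂) ++ ff
      ≡ a ++ t ++ d₁ ++ f ++ f ++ d₂ ++ f001 ++ f ++ d₃ ++ f ++ f ++ d₂ ++ ff
  reassociate = solve-++ 8 (λ a t d₁ f d₂ f001 d₃ ff →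
    (((((((((((a ⊕ t) ⊕ d₁) ⊕ f) ⊕ f) ⊕ d₂) ⊕ f001) ⊕ f) ⊕ d₃) ⊕ f) ⊕ f) ⊕ d₂) ⊕ ff
      ⊜ a ⊕ t ⊕ d₁ ⊕ f ⊕ f ⊕ d₂ ⊕ f001 ⊕ f ⊕ d₃ ⊕ f ⊕ f ⊕ d₂ ⊕ ff) refl
  encSLP-digits : encℕ (suc m) ++ encℕ m ++ true ∷ false ∷ encℕ (suc (suc m)) ++ encℕ m ++ []
      ≡ digitsℕ (suc m) ++ false ∷ false ∷ digitsℕ m ++ false ∷ false ∷ true ∷ false ∷
          digitsℕ (suc (suc m)) ++ false ∷ false ∷ digitsℕ m ++ false ∷ false ∷ []
  encSLP-digits =
    trans (encℕ-digitsℕ (suc m) _) (cong (λ bs → digitsℕ (suc m) ++ false ∷ false ∷ bs)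
    (trans (encℕ-digitsℕ m _) (cong (λ bs → digitsℕ m ++ false ∷ false ∷ true ∷ false ∷ bs)
    (trans (encℕ-digitsℕ (suc (suc m)) _) (cong (λ bs → digitsℕ (suc (suc m)) ++ false ∷ false ∷ bs)
    (encℕ-digitsℕ m []))))))

tapeBound : ℕ → ℕ
tapeBound a = 9 * a + 40

length-++-≤ : ∀ {A : Set} (xs ys : List A) {m n} → length xs ≤ m → length ys ≤ n → length (xs ++ ys) ≤ m + n
length-++-≤ xs ys xs≤ ys≤ = ≤-trans (≤-reflexive (length-++ xs)) (+-mono-≤ xs≤ ys≤)

length-digitsℕ≤ : ∀ v k a → v ≤ 2 → k ≤ a → length (digitsℕ (v + suc k)) ≤ 2 * a + 6
length-digitsℕ≤ v k a v≤2 k≤a =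
  ≤-trans (length-digitsℕ (v + suc k)) (≤-trans (*-monoʳ-≤ 2 (+-mono-≤ v≤2 (s≤s k≤a)))
  (≤-reflexive (solve-ℕ 1 (λ a → con 2 :* (con 2 :+ (con 1 :+ a)) := con 2 :* a :+ con 6) refl a)))

module _ {k a : ℕ} (k≤a : k ≤ a) where

  length-written₁ : length (written₁ (suc k)) ≤ 2 * a + 16
  length-written₁ = ≤-trans
    (length-++-≤ (D ++ false ∷ []) (false ∷ []) (length-++-≤ D (false ∷ [])
      (length-++-≤ (written₀ (suc k)) (digitsℕ (1 + suc k)) ≤-refl (length-digitsℕ≤ 1 k a (s≤s z≤n) k≤a)) ≤-refl) ≤-refl)
    (≤-reflexive (solve-ℕ 1 (λ a → con 8 :+ (con 2 :* a :+ con 6) :+ con 1 :+ con 1 := con 2 :* a :+ con 16) refl a))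
    where D = written₀ (suc k) ++ digitsℕ (1 + suc k)

  length-written₂ : length (written₂ (suc k)) ≤ 4 * a + 26
  length-written₂ = ≤-trans
    (length-++-≤ (D ++ false ∷ false ∷ true ∷ []) (false ∷ []) (length-++-≤ D (false ∷ false ∷ true ∷ [])
      (length-++-≤ (written₁ (suc k)) (digitsℕ (0 + suc k)) length-written₁ (length-digitsℕ≤ 0 k a z≤n k≤a))
      ≤-refl) ≤-refl)
    (≤-reflexive (solve-ℕ 1 (λ a → con 2 :* a :+ con 16 :+ (con 2 :* a :+ con 6) :+ con 3 :+ con 1
                                   := con 4 :* a :+ con 26) refl a))
    where D = written₁ (suc k) ++ digitsℕ (0 + suc k)

  length-written₃ : length (written₃ (suc k)) ≤ 6 * a + 34
  length-written₃ = ≤-trans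
    (length-++-≤ (D ++ false ∷ []) (false ∷ []) (length-++-≤ D (false ∷ [])
      (length-++-≤ (written₂ (suc k)) (digitsℕ (2 + suc k)) length-written₂ (length-digitsℕ≤ 2 k a ≤-refl k≤a))
      ≤-refl) ≤-refl)
    (≤-reflexive (solve-ℕ 1 (λ a → con 4 :* a :+ con 26 :+ (con 2 :* a :+ con 6) :+ con 1 :+ con 1
                                   := con 6 :* a :+ con 34) refl a))
    where D = written₂ (suc k) ++ digitsℕ (2 + suc k)

  length-suffixBits : length (suffixBits (suc k)) ≤ 8 * a + 40
  length-suffixBits = ≤-trans
    (length-++-≤ (written₃ (suc k)) (digitsℕ (0 + suc k)) length-written₃ (length-digitsℕ≤ 0 k a z≤n k≤a))
    (≤-reflexive (solve-ℕ 1 (λ a → con 6 :* a :+ con 34 :+ (con 2 :* a :+ con 6) := con 8 :* a :+ con 40) refl a))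

budget≤tapeBound : ∀ Frʳ zs v → v ≤ 2 → length zs ≤ 6 * length Frʳ + 34 →
  budget Frʳ [] zs v ≤ tapeBound (length Frʳ)
budget≤tapeBound Frʳ zs v v≤2 zs≤ =
  ≤-trans (+-mono-≤ (+-monoʳ-≤ (length Frʳ + 0) zs≤) (*-monoʳ-≤ 2 (s≤s (+-mono-≤ (marks≤length Frʳ) v≤2))))
    (≤-reflexive (solve-ℕ 1 (λ a → a :+ con 0 :+ (con 6 :* a :+ con 34) :+ con 2 :* (con 1 :+ (a :+ con 2))
                                   := con 9 :* a :+ con 40) refl (length Frʳ)))

passesTime : ℕ → ℕ
passesTime a = 10 + (P + (2 + (P + (6 + (P + (2 + (P + 2)))))))
  where P = passTime a (tapeBound a)

boundedPass : ∀ p b a Frʳ k zs z v → All (Pending p) Frʳ → length Frʳ ≡ a → marks Frʳ ≡ k → v ≤ 2 →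
  length (zs ++ z ∷ []) ≤ 6 * a + 34 → (s : Inside (map bit (zs ++ z ∷ []) ++ counterℕ v)) →
  ⟪ seek p ∣ Frʳ ++ mark (parity p) true b ∷ [] ∣ s ⟫ᵢ
    ↝[ passTime a (tapeBound a) ]
  ⟪ flush p ∣ map bit ((zs ++ z ∷ []) ++ digitsℕ (v + suc k)) ʳ++ (map flipMark Frʳ ++ mark (not (parity p)) true b ∷ [])
          ∣ [] ⟫
boundedPass p b a Frʳ k zs z v pending refl marks≡ v≤2 zs≤ =
  pass p b (tapeBound a) Frʳ k zs z v pending marks≡ (budget≤tapeBound Frʳ (zs ++ z ∷ []) v v≤2 zs≤)

-- Frʳ is the scanned input after its first cell, listed right to left.
passes : ∀ b Frʳ → All (Pending pass₀) Frʳ →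
  ⟪ scanning instr ∣ Frʳ ++ mark true true b ∷ [] ∣ [] ⟫
    ↝[ passesTime (length Frʳ) ]
  ⟪ cleanup ∣ map bit (suffixBits (suc (marks Frʳ))) ʳ++ (flip⁴ Frʳ ++ mark true true b ∷ [])
            ∣ bit false ∷ bit false ∷ [] ⟫
passes b Frʳ pending₀ =
  ↝-trans (emit-pass₀ (Frʳ ++ mark true true b ∷ []))
  (↝-trans (boundedPass pass₀ b a Frʳ k bits₀ true 1 pending₀ refl refl (s≤s z≤n)
                        (fits 0 8 ≤-refl z≤n (m≤m+n 8 26)) start₀)
  (↝-trans (emit-pass₁ after₀ (Frʳ₁ ++ mark false true b ∷ []))
  (↝-trans (boundedPass pass₁ b a Frʳ₁ k (after₀ ++ false ∷ []) false 0 pending₁ length₁ marks₁ z≤n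
                        (fits 2 16 (length-written₁ k≤a) (m≤m+n 2 4) (m≤m+n 16 18)) (startAfter00 after₀))
  (↝-trans (emit-pass₂ after₁ (Frʳ₂ ++ mark true true b ∷ []))
  (↝-trans (boundedPass pass₂ b a Frʳ₂ k (after₁ ++ false ∷ false ∷ true ∷ []) false 2 pending₂ length₂ marks₂
                        ≤-refl
                        (fits 4 26 (length-written₂ k≤a) (m≤m+n 4 2) (m≤m+n 26 8)) (start₂ after₁))
  (↝-trans (emit-pass₃ after₂ (Frʳ₃ ++ mark false true b ∷ []))
  (↝-trans (boundedPass pass₃ b a Frʳ₃ k (after₂ ++ false ∷ []) false 0 pending₃ length₃ marks₃ z≤n
                        (length-written₃ k≤a) (startAfter00 after₂))
  (emit-cleanup _))))))))
  where
  a = length Frʳ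
  k = marks Frʳ
  m = suc k
  after₀ = written₀ m ++ digitsℕ (suc m)
  after₁ = written₁ m ++ digitsℕ m
  after₂ = written₂ m ++ digitsℕ (suc (suc m))
  Frʳ₁ = map flipMark Frʳ
  Frʳ₂ = map flipMark Frʳ₁
  Frʳ₃ = map flipMark Frʳ₂
  pending₁ = pending-flip refl pending₀
  pending₂ = pending-flip refl pending₁
  pending₃ = pending-flip refl pending₂
  length₁ = length-map flipMark Frʳ
  length₂ = trans (length-map flipMark Frʳ₁) length₁
  length₃ = trans (length-map flipMark Frʳ₂) length₂
  marks₁ = marks-flipMark Frʳ
  marks₂ = trans (marks-flipMark Frʳ₁) marks₁
  marks₃ = trans (marks-flipMark Frʳ₂) marks₂
  k≤a = marks≤length Frʳ
  fits : ∀ {n} c d → n ≤ c * a + d → c ≤ 6 → d ≤ 34 → n ≤ 6 * a + 34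
  fits c d n≤ c≤6 d≤34 = ≤-trans n≤ (+-mono-≤ (*-monoˡ-≤ a c≤6) d≤34)

pending-cleanable : ∀ {p c} → Pending p c → SweepsLeft cleanup (bit ∘ cellBit) c
pending-cleanable (pending-bit b)  = refl
pending-cleanable (pending-mark b) = refl

readBits-bits : ∀ bs ys → readBits machine (map encodeCell (map bit bs ++ ys)) ≡ bs ++ readBits machine (map encodeCell ys)
readBits-bits []           ys = refl
readBits-bits (false ∷ bs) ys = cong (false ∷_) (readBits-bits bs ys)
readBits-bits (true ∷ bs)  ys = cong (true ∷_) (readBits-bits bs ys)

cellBits-bits : ∀ bs → map cellBit (map bit bs) ≡ bs
cellBits-bits bs = trans (sym (map-∘ bs)) (map-id bs)

bits-cleanable : ∀ bs → All (SweepsLeft cleanup (bit ∘ cellBit)) (map bit bs)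
bits-cleanable bs = map⁺ (All.tabulate {xs = bs} (λ _ → refl))

All-ʳ++ : ∀ {P : Cell → Set} xs {ys} → All P xs → All P ys → All P (xs ʳ++ ys)
All-ʳ++ []       []       qs = qs
All-ʳ++ (x ∷ xs) (p ∷ ps) qs = All-ʳ++ xs ps (p ∷ qs)

cleanup-halts : ∀ t b X → All (SweepsLeft cleanup (bit ∘ cellBit)) X →
  Halts ⟪ cleanup ∣ X ʳ++ (mark t true b ∷ []) ∣ bit false ∷ bit false ∷ [] ⟫
        (suc (length X) + 1) (b ∷ map cellBit X ++ false ∷ false ∷ [])
cleanup-halts t b X cleanable =
  ⟪ halt ∣ [] ∣ T ⟫ ,
  ↝-trans (sweepLeft X {mark t true b} {[]} {bit false} {bit false ∷ []} cleanable refl)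
          (stepS {cleanup} {[]} {mark t true b ∷ map (bit ∘ cellBit) X ++ bit false ∷ bit false ∷ []} refl) ,
  stepHalt {halt} {[]} {T} refl ,
  trans (cong (λ Y → readBits machine (map encodeCell (bit b ∷ Y ++ bit false ∷ bit false ∷ []))) (map-∘ X))
        (readBits-bits (b ∷ map cellBit X) (bit false ∷ bit false ∷ []))
  where
  T = bit b ∷ map (bit ∘ cellBit) X ++ bit false ∷ bit false ∷ []

-- Y lists the input cells after the first one from right to left.
cleanup-after-passes : ∀ b Y S → All (Pending pass₀) Y →
  Halts ⟪ cleanup ∣ map bit S ʳ++ (Y ++ mark true true b ∷ []) ∣ bit false ∷ bit false ∷ [] ⟫
        (suc (length Y + length S) + 1) (b ∷ reverse (map cellBit Y) ++ S ++ false ∷ false ∷ [])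
cleanup-after-passes b Y S pending =
  Halts-cast context length≡ output≡
    (cleanup-halts true b X (++⁺ (All-ʳ++ Y (All.map pending-cleanable pending) []) (bits-cleanable S)))
  where
  X = reverse Y ++ map bit S
  context : ⟪ cleanup ∣ X ʳ++ (mark true true b ∷ []) ∣ bit false ∷ bit false ∷ [] ⟫
          ≡ ⟪ cleanup ∣ map bit S ʳ++ (Y ++ mark true true b ∷ []) ∣ bit false ∷ bit false ∷ [] ⟫
  context = cong (λ L → ⟪ cleanup ∣ L ∣ bit false ∷ bit false ∷ [] ⟫)
    (trans (++-ʳ++ (reverse Y)) (cong (map bit S ʳ++_) (trans (ʳ++-defn (reverse Y)) (cong (_++ _) (reverse-involutive Y)))))
  length≡ : suc (length X) + 1 ≡ suc (length Y + length S) + 1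
  length≡ = cong (λ n → suc n + 1) (trans (length-++ (reverse Y)) (cong₂ _+_ (length-reverse Y) (length-map bit S)))
  output≡ : b ∷ map cellBit X ++ false ∷ false ∷ [] ≡ b ∷ reverse (map cellBit Y) ++ S ++ false ∷ false ∷ []
  output≡ = cong (b ∷_) (begin
    map cellBit (reverse Y ++ map bit S) ++ false ∷ false ∷ []
      ≡⟨ cong (_++ false ∷ false ∷ []) (map-++ cellBit (reverse Y) (map bit S)) ⟩
    (map cellBit (reverse Y) ++ map cellBit (map bit S)) ++ false ∷ false ∷ []
      ≡⟨ cong (λ bs → (bs ++ map cellBit (map bit S)) ++ false ∷ false ∷ []) (reverse-map cellBit Y) ⟩
    (reverse (map cellBit Y) ++ map cellBit (map bit S)) ++ false ∷ false ∷ []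
      ≡⟨ cong (λ bs → (reverse (map cellBit Y) ++ bs) ++ false ∷ false ∷ []) (cellBits-bits S) ⟩
    (reverse (map cellBit Y) ++ S) ++ false ∷ false ∷ []
      ≡⟨ ++-assoc (reverse (map cellBit Y)) S _ ⟩
    reverse (map cellBit Y) ++ S ++ false ∷ false ∷ [] ∎)
    where open ≡-Reasoning

afterScanTime : ℕ → ℕ
afterScanTime a = passesTime a + (suc (a + (8 * a + 40)) + 1)

afterScan-halts : ∀ b Frʳ → All (Pending pass₀) Frʳ →
  Halts ⟪ scanning instr ∣ Frʳ ++ mark true true b ∷ [] ∣ [] ⟫ (afterScanTime (length Frʳ))
        (b ∷ reverse (map cellBit Frʳ) ++ encSLP (negSquareSuffix (suc (marks Frʳ))))
afterScan-halts b Frʳ pending =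
  Halts-cast refl refl output≡ (Halts-weaken time
    (↝-Halts (passes b Frʳ pending) (cleanup-after-passes b (flip⁴ Frʳ) S pending⁴)))
  where
  a = length Frʳ
  S = suffixBits (suc (marks Frʳ))
  pending⁴ : All (Pending pass₀) (flip⁴ Frʳ)
  pending⁴ = pending-flip {pass₃} {pass₀} refl (pending-flip {pass₂} {pass₃} refl
             (pending-flip {pass₁} {pass₂} refl (pending-flip {pass₀} {pass₁} refl pending)))
  time : passesTime a + (suc (length (flip⁴ Frʳ) + length S) + 1) ≤ afterScanTime a
  time = +-monoʳ-≤ (passesTime a) (+-monoˡ-≤ 1 (s≤s
    (+-mono-≤ (≤-reflexive (flip⁴-invariant length (length-map flipMark) Frʳ)) (length-suffixBits (marks≤length Frʳ)))))
  output≡ : b ∷ reverse (map cellBit (flip⁴ Frʳ)) ++ S ++ false ∷ false ∷ []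
          ≡ b ∷ reverse (map cellBit Frʳ) ++ encSLP (negSquareSuffix (suc (marks Frʳ)))
  output≡ = cong (b ∷_) (cong₂ _++_ (cong reverse (flip⁴-invariant (map cellBit) cellBits-flipMark Frʳ))
                                  (suffixBits-encSLP (suc (marks Frʳ))))

acceptTime : ℕ → ℕ
acceptTime a = 1 + a + afterScanTime a

accept-halts : ∀ b w Fr → markInput (firstOp b) w ≡ just Fr →
  Halts ⟪ start ∣ [] ∣ map bit (b ∷ w) ⟫ (acceptTime (length w)) ((b ∷ w) ++ encSLP (negSquareSuffix (suc (marks Fr))))
accept-halts b w Fr e =
  ↝-Halts (↝-trans (stepR {start} {[]} {map bit (b ∷ w)} (transition-start b)) (scan-accepts (firstOp b) w e))
    (Halts-cast (cong (λ L → ⟪ scanning instr ∣ L ∣ [] ⟫) (sym (ʳ++-defn Fr)))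
                (cong afterScanTime length≡)
                (cong₂ (λ bs k → b ∷ bs ++ encSLP (negSquareSuffix (suc k))) cellBits≡ marks≡)
                (afterScan-halts b (reverse Fr) (All-ʳ++ Fr (markInput-pending (firstOp b) w e) [])))
  where
  cellBits : map cellBit Fr ≡ w
  cellBits = markInput-cellBits (firstOp b) w e
  length≡ : length (reverse Fr) ≡ length w
  length≡ = trans (length-reverse Fr) (trans (sym (length-map cellBit Fr)) (cong length cellBits))
  cellBits≡ : reverse (map cellBit (reverse Fr)) ≡ w
  cellBits≡ = trans (cong reverse (reverse-map cellBit Fr)) (trans (reverse-involutive _) cellBits)
  marks≡ : marks (reverse Fr) ≡ marks Fr
  marks≡ = trans (marks-ʳ++ Fr []) (+-identityʳ (marks Fr))

timeBound : ℕ → ℕ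
timeBound n = 200 * suc n ^ 2

-- acceptTime a = 72 a² + 490 a + 729.
acceptTime≤timeBound : ∀ a → acceptTime a ≤ timeBound (suc a)
acceptTime≤timeBound a = ≤-trans (m≤m+n (acceptTime a) (128 * (a * a) + 310 * a + 71))
  (≤-reflexive (solve-ℕ 1 (λ a →
    con 1 :+ a :+ ((con 10 :+ (P a :+ (con 2 :+ (P a :+ (con 6 :+ (P a :+ (con 2 :+ (P a :+ con 2))))))))
      :+ ((con 1 :+ (a :+ (con 8 :* a :+ con 40))) :+ con 1))
    :+ (con 128 :* (a :* a) :+ con 310 :* a :+ con 71)
    := con 200 :* ((con 2 :+ a) :* ((con 2 :+ a) :* con 1))) refl a))
  where
  P = λ a → (con 1 :+ a) :* (con 2 :* (con 9 :* a :+ con 40) :+ con 4) :+ (con 2 :* (con 9 :* a :+ con 40) :+ con 2)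

rejectTime≤timeBound : ∀ a → 1 + (a + 4) ≤ timeBound (suc a)
rejectTime≤timeBound a = ≤-trans (m≤m+n (1 + (a + 4)) (200 * (a * a) + 799 * a + 795))
  (≤-reflexive (solve-ℕ 1 (λ a → con 1 :+ (a :+ con 4) :+ (con 200 :* (a :* a) :+ con 799 :* a :+ con 795)
                                 := con 200 :* ((con 2 :+ a) :* ((con 2 :+ a) :* con 1))) refl a))

machine-computes : ∀ w → Halts (initConf machine w) (timeBound (length w)) (reduce w)
machine-computes [] = Halts-weaken (m≤m+n 4 196) (reject-halts start [] [] refl)
machine-computes (b ∷ w) rewrite initConf-∷ b w | reduce-∷ b w with markInput (firstOp b) w in e
... | just Fr = Halts-weaken (acceptTime≤timeBound (length w)) (accept-halts b w Fr e)
... | nothing = Halts-weaken (rejectTime≤timeBound (length w))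
                  (↝-Halts (stepR {start} {[]} {map bit (b ∷ w)} (transition-start b))
                           (scan-rejects (firstOp b) w {mark true true b ∷ []} e))

reduce-polyTime : PolyTimeComputable reduce
reduce-polyTime = machine , 200 , 2 , λ w → haltsWithin-Halts (machine-computes w)

mainTheorem9 : EquSLP ≤P 3SoSSLP
mainTheorem9 = reduce , reduce-polyTime , λ w → EquSLP⇒3SoSSLP-reduce w , 3SoSSLP-reduce⇒EquSLP w
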